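{- Let $q$ be a prime and $d=q^r$ with $r\ge 1$. Let $G\le \mathrm{AGL}_1(q)\wr S_d$ and let $\sigma\in G$ be an element mapping to a $d$-cycle under the projection $G\to S_d$. Set $G_q:=G\cap C_q^d$, let $e$ be the rank of the elementary-abelian group $G_q$, and let $Q\le G$ be a $q$-Sylow subgroup. Then $Q$ has nilpotency class at least $e$.
   Context: $\mathrm{AGL}_1(q)=\mathbb{F}_q\rtimes\mathbb{F}_q^\times$ acting on $\mathbb{F}_q$; $\mathrm{AGL}_1(q)\wr S_d=\mathrm{AGL}_1(q)^d\rtimes S_d$ with $S_d$ permuting the copies, and $C_q^d\le\mathrm{AGL}_1(q)^d$ is the subgroup of translations in each coordinate. The nilpotency class of a nilpotent group $Q$ is the least $i$ with $Q_i=1$, where $Q_0=Q$, $Q_i=[Q_{i-1},Q]$. -}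

module Defs where

open import Data.Nat using (ℕ; zero; suc; _+_; _*_; NonZero)
open import Data.Nat.DivMod using (_mod_)
open import Data.Fin using (Fin; toℕ)
open import Data.Vec using (Vec; []; _∷_; lookup; tabulate)
open import Data.List using (List; []; _∷_; concatMap; map; allFin)
open import Data.Bool using (Bool; true; false; if_then_else_; _∧_)
import Data.Fin as F
open import Data.Vec.Properties using (≡-dec)
open import Relation.Nullary.Decidable using (⌊_⌋)
open import Data.Product using (Σ; ∃; _×_; _,_)
open import Relation.Binary.PropositionalEquality using (_≡_; _≢_)
open import Function using (_∘_)

allVec : (n m : ℕ) → List (Vec (Fin m) n)
allVec zero    m = [] ∷ []
allVec (suc n) m = concatMap (λ i → map (i ∷_) (allVec n m)) (allFin m)

count : {A : Set} → (A → Bool) → List A → ℕ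
count P []       = 0
count P (x ∷ xs) = if P x then suc (count P xs) else count P xs

iter : {A : Set} → (A → A) → ℕ → A → A
iter f zero    x = x
iter f (suc k) x = f (iter f k x)

-- The wreath product AGL₁(q) ≀ S_d, realised as permutations of
-- {0..d-1} × F_q :  an element (π , a , b) acts by
--   (i , x) ↦ (π i , aᵢ x + bᵢ) ,   with π a permutation and aᵢ ≠ 0.
-- Here F_q = Fin q with arithmetic modulo q (q prime in the statement).
module Wr (q : ℕ) .{{_ : NonZero q}} (d : ℕ) where

  _+F_ : Fin q → Fin q → Fin q
  x +F y = (toℕ x + toℕ y) mod q

  _*F_ : Fin q → Fin q → Fin q
  x *F y = (toℕ x * toℕ y) mod q

  0F 1F : Fin q
  0F = 0 mod q
  1F = 1 mod q

  Raw : Set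
  Raw = Vec (Fin d) d × Vec (Fin q) d × Vec (Fin q) d

  Valid : Raw → Set
  Valid (π , a , b) = (∀ j → ∃ λ i → lookup π i ≡ j) × (∀ i → lookup a i ≢ 0F)

  allRaw : List Raw
  allRaw = concatMap (λ π → concatMap (λ a → map (λ b → (π , a , b)) (allVec d q)) (allVec d q)) (allVec d d)

  -- composition: (g · h) (p) = g (h p)
  _·_ : Raw → Raw → Raw
  (πg , ag , bg) · (πh , ah , bh) =
      tabulate (λ i → lookup πg (lookup πh i))
    , tabulate (λ i → lookup ag (lookup πh i) *F lookup ah i)
    , tabulate (λ i → (lookup ag (lookup πh i) *F lookup bh i) +F lookup bg (lookup πh i))

  one : Raw
  one = tabulate (λ i → i) , tabulate (λ _ → 1F) , tabulate (λ _ → 0F)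

  Subset : Set
  Subset = Raw → Bool

  _∈_ : Raw → Subset → Set
  x ∈ H = H x ≡ true

  _⊆_ : Subset → Subset → Set
  H ⊆ K = ∀ x → x ∈ H → x ∈ K

  record IsSubgroup (H : Subset) : Set where
    field
      valid  : ∀ x → x ∈ H → Valid x
      one∈   : one ∈ H
      mul∈   : ∀ x y → x ∈ H → y ∈ H → (x · y) ∈ H
      inv∈   : ∀ x → x ∈ H → ∃ λ y → y ∈ H × (x · y ≡ one) × (y · x ≡ one)

  ∣_∣ : Subset → ℕ
  ∣ H ∣ = count H allRaw

  inCqd : Subset
  inCqd (π , a , b) = ⌊ ≡-dec F._≟_ π (tabulate (λ i → i)) ⌋ ∧ ⌊ ≡-dec F._≟_ a (tabulate (λ _ → 1F)) ⌋

  _∩_ : Subset → Subset → Subset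
  (H ∩ K) x = H x ∧ K x

  IsDCycle : Vec (Fin d) d → Set
  IsDCycle π = ∀ i j → ∃ λ k → iter (lookup π) k i ≡ j

  data Gen (S : Raw → Set) : Raw → Set where
    gen  : ∀ {x} → S x → Gen S x
    gone : Gen S one
    gmul : ∀ {x y} → Gen S x → Gen S y → Gen S (x · y)
    ginv : ∀ {x y} → Gen S x → x · y ≡ one → y · x ≡ one → Gen S y

  Comm : (Raw → Set) → (Raw → Set) → Raw → Set
  Comm A B z = ∃ λ x → ∃ λ y → ∃ λ x' → ∃ λ y' →
    A x × B y × (x · x' ≡ one) × (y · y' ≡ one) × (z ≡ ((x' · y') · x) · y)

  LCS : Subset → ℕ → Raw → Set
  LCS Q zero    x = x ∈ Q
  LCS Q (suc i) x = Gen (Comm (LCS Q i) (λ y → y ∈ Q)) x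

{-# OPTIONS --safe #-}
module Submission where

open import Defs
open import Data.Nat using (ℕ; _≤_; _*_; _^_)
open import Data.Nat.Divisibility using (_∣_)
open import Data.Nat.Primality using (Prime; prime⇒nonZero)
open import Data.Product using (_×_; proj₁)
open import Relation.Binary.PropositionalEquality using (_≡_)
open import Relation.Nullary using (¬_)
open import Data.Nat using (NonZero)

-- Write G_q = G ∩ C_q^d. The coset space G/Q has m elements, prime to q, so every q-group
-- acting on it has a fixed point. For the commuting translations of G_q, a normal subgroup of G,
-- a common fixed coset gives G_q ⊆ Q; for the q-part of σ, still a d-cycle because d is a power
-- of q, a fixed coset conjugates it into an element τ ∈ Q whose permutation is a d-cycle.
-- A translation that commutes with τ and vanishes at one point i₀ is trivial, so on translations
-- the commutator map t ↦ [t, τ] is injective once the value of t at i₀ is known. Since i-fold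
-- commutators with τ land in the trivial term Q_i, an element t ∈ G_q is determined by the values
-- at i₀ of t, [t, τ], …, up to i − 1 commutators: hence q^e = |G_q| ≤ q^i.

module Counting where
  open import Defs using (count; allVec)
  open import Data.Bool using (Bool; true; false; _∧_; not)
  open import Data.Bool.Properties using () renaming (_≟_ to _≟ᵇ_)
  open import Data.Fin using (Fin)
  open import Data.List using (List; []; _∷_; _++_; map; concatMap; filter; length; lookup; allFin; cartesianProductWith; findᵇ)
  open import Data.List.Properties using (length-++; length-map; length-tabulate; map-++; map-∘)
  open import Data.List.Membership.Propositional using (_∈_)
  open import Data.List.Membership.Propositional.Properties
    using (∈-filter⁺; ∈-filter⁻; ∈-allFin; ∈-cartesianProductWith⁺)
  open import Data.List.Membership.Propositional.Properties.WithK using (unique∧set⇒bag)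
  open import Data.List.Membership.DecPropositional using () renaming (_∈?_ to ∈?)
  open import Data.List.Relation.Unary.Any using (here; there; index)
  open import Data.List.Relation.Unary.Any.Properties using (lookup-index)
  open import Data.List.Relation.Unary.All using ([])
  import Data.List.Relation.Unary.All as All
  import Data.List.Relation.Unary.All.Properties as All
  open import Data.List.Relation.Unary.AllPairs using ([]; _∷_)
  open import Data.List.Relation.Unary.Unique.Propositional using (Unique)
  import Data.List.Relation.Unary.Unique.Propositional.Properties as Unique
  open import Data.List.Relation.Binary.BagAndSetEquality using (∼bag⇒↭)
  open import Data.List.Relation.Binary.Permutation.Propositional.Properties using (↭-length)
  open import Data.Nat using (ℕ; zero; suc; _+_; _*_; _^_; _≤_; _<_; z≤n; s≤s)
  open import Data.Nat.Properties using (+-suc; m≤n⇒m≤1+n; n<1+n)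
  import Data.Fin as Fin
  open import Data.Fin.Properties using (pigeonhole)
  open import Data.Product using (∃; ∃₂; _×_; _,_; proj₂)
  open import Data.Maybe using (just)
  open import Data.Vec using (Vec; []; _∷_)
  open import Data.Vec.Properties using (∷-injective)
  open import Function using (_⇔_; mk⇔; Equivalence)
  open import Relation.Binary.Definitions using (DecidableEquality)
  open import Relation.Binary.PropositionalEquality using (_≡_; refl; sym; trans; cong; cong₂; subst)
  open import Relation.Nullary using (Dec; yes; no; does; ¬_)
  open import Relation.Nullary.Decidable using (dec-true)

  ∧-true⁻ : ∀ {a b} → a ∧ b ≡ true → a ≡ true × b ≡ true
  ∧-true⁻ {true} {true} _ = refl , refl

  ∧-not-true⁻ : ∀ {a b} → a ∧ not b ≡ true → a ≡ true × b ≡ false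
  ∧-not-true⁻ {true} {false} _ = refl , refl

  does-true⁻ : ∀ {P : Set} (P? : Dec P) → does P? ≡ true → P
  does-true⁻ (yes p) _ = p

  does-false⁻ : ∀ {P : Set} (P? : Dec P) → does P? ≡ false → ¬ P
  does-false⁻ (no ¬p) _ = ¬p

  module _ {A : Set} where

    count-cong : ∀ {P R : A → Bool} → (∀ x → P x ≡ R x) → ∀ xs → count P xs ≡ count R xs
    count-cong P≗R []       = refl
    count-cong {P} {R} P≗R (x ∷ xs) rewrite P≗R x with R x
    ... | true  = cong suc (count-cong P≗R xs)
    ... | false = count-cong P≗R xs

    count-split : ∀ (P R : A → Bool) xs →
      count P xs ≡ count (λ x → P x ∧ R x) xs + count (λ x → P x ∧ not (R x)) xs
    count-split P R [] = refl
    count-split P R (x ∷ xs) with P x | R x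
    ... | true  | true  = cong suc (count-split P R xs)
    ... | true  | false = trans (cong suc (count-split P R xs)) (sym (+-suc _ _))
    ... | false | true  = count-split P R xs
    ... | false | false = count-split P R xs

    count≤length : ∀ (P : A → Bool) xs → count P xs ≤ length xs
    count≤length P [] = z≤n
    count≤length P (x ∷ xs) with P x
    ... | true  = s≤s (count≤length P xs)
    ... | false = m≤n⇒m≤1+n (count≤length P xs)

    count>0 : ∀ {P : A → Bool} {x xs} → x ∈ xs → P x ≡ true → 0 < count P xs
    count>0 {P} {xs = y ∷ ys} x∈xs Px with P y in Py | x∈xs
    ... | true  | _          = s≤s z≤n
    ... | false | here refl  with () ← trans (sym Px) Py
    ... | false | there x∈ys = count>0 x∈ys Px

    count>0⇒∃ : ∀ (P : A → Bool) xs → 0 < count P xs → ∃ λ x → P x ≡ true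
    count>0⇒∃ P (x ∷ xs) pos with P x in Px
    ... | true  = x , Px
    ... | false = count>0⇒∃ P xs pos

    count≡length∘filter : ∀ (P : A → Bool) xs → count P xs ≡ length (filter (λ x → P x ≟ᵇ true) xs)
    count≡length∘filter P [] = refl
    count≡length∘filter P (x ∷ xs) with P x
    ... | true  = cong suc (count≡length∘filter P xs)
    ... | false = count≡length∘filter P xs

    Unique-map⁺-on : ∀ {B : Set} {f : A → B} {xs} → (∀ {x y} → x ∈ xs → y ∈ xs → f x ≡ f y → x ≡ y) →
      Unique xs → Unique (map f xs)
    Unique-map⁺-on {xs = []}     inj []                 = []
    Unique-map⁺-on {xs = x ∷ xs} inj (x∉xs ∷ xs-unique) =
      All.map⁺ (All.tabulate (λ y∈ fx≡fy → All.lookup x∉xs y∈ (inj (here refl) (there y∈) fx≡fy)))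
        ∷ Unique-map⁺-on (λ x∈ y∈ → inj (there x∈) (there y∈)) xs-unique

    findᵇ-cong : ∀ {p p′ : A → Bool} → (∀ x → p x ≡ p′ x) → ∀ xs → findᵇ p xs ≡ findᵇ p′ xs
    findᵇ-cong p≗p′ []       = refl
    findᵇ-cong {p} {p′} p≗p′ (x ∷ xs) rewrite p≗p′ x with p′ x
    ... | true  = refl
    ... | false = findᵇ-cong p≗p′ xs

    findᵇ-sound : ∀ (p : A → Bool) xs {w} → findᵇ p xs ≡ just w → p w ≡ true
    findᵇ-sound p (x ∷ xs) found with p x in px
    findᵇ-sound p (x ∷ xs) refl | true  = px
    findᵇ-sound p (x ∷ xs) found | false = findᵇ-sound p xs found

    findᵇ-complete : ∀ (p : A → Bool) {x xs} → x ∈ xs → p x ≡ true → ∃ λ w → findᵇ p xs ≡ just w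
    findᵇ-complete p {xs = y ∷ ys} x∈ px with p y in py | x∈
    ... | true  | _          = y , refl
    ... | false | here refl  with () ← trans (sym px) py
    ... | false | there x∈ys = findᵇ-complete p x∈ys px

  module Enumeration {A : Set} (L : List A) (L-complete : ∀ x → x ∈ L) (L-unique : Unique L) where

    count≡length : ∀ (P : A → Bool) {xs} → Unique xs → (∀ {x} → P x ≡ true ⇔ x ∈ xs) → count P L ≡ length xs
    count≡length P {xs} xs-unique P⇔∈xs =
      trans (count≡length∘filter P L) (↭-length (∼bag⇒↭ (unique∧set⇒bag (Unique.filter⁺ P? {L} L-unique) xs-unique same)))
      where
        P? : ∀ x → Dec (P x ≡ true)
        P? x = P x ≟ᵇ true
        same : ∀ {x} → x ∈ filter P? L ⇔ x ∈ xs
        same = mk⇔ (λ x∈ → Equivalence.to P⇔∈xs (proj₂ (∈-filter⁻ P? {xs = L} x∈)))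
                   (λ x∈ → ∈-filter⁺ P? (L-complete _) (Equivalence.from P⇔∈xs x∈))

    unique-length≤ : DecidableEquality A → ∀ {xs} → Unique xs → length xs ≤ length L
    unique-length≤ _≟_ {xs} xs-unique =
      subst (_≤ length L) (count≡length (λ x → does (∈? _≟_ x xs)) xs-unique ∈⇔) (count≤length _ L)
      where
        ∈⇔ : ∀ {x} → does (∈? _≟_ x xs) ≡ true ⇔ x ∈ xs
        ∈⇔ {x} = mk⇔ to (dec-true (∈? _≟_ x xs))
          where
            to : does (∈? _≟_ x xs) ≡ true → x ∈ xs
            to h with ∈? _≟_ x xs
            ... | yes x∈xs = x∈xs

    pigeonhole-ℕ : (g : ℕ → A) → ∃₂ λ a b → a < b × g a ≡ g b
    pigeonhole-ℕ g with pigeonhole (n<1+n (length L)) (λ k → index (L-complete (g (Fin.toℕ k))))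
    ... | a , b , a<b , same-index = Fin.toℕ a , Fin.toℕ b , a<b ,
      trans (lookup-index (L-complete _)) (trans (cong (lookup L) same-index) (sym (lookup-index (L-complete _))))

  module _ {A B C : Set} (f : A → B → C) where

    concatMap-map≡cartesianProductWith : ∀ xs ys → concatMap (λ x → map (f x) ys) xs ≡ cartesianProductWith f xs ys
    concatMap-map≡cartesianProductWith []       ys = refl
    concatMap-map≡cartesianProductWith (x ∷ xs) ys = cong (map (f x) ys ++_) (concatMap-map≡cartesianProductWith xs ys)

    length-cartesianProductWith : ∀ xs ys → length (cartesianProductWith f xs ys) ≡ length xs * length ys
    length-cartesianProductWith []       ys = refl
    length-cartesianProductWith (x ∷ xs) ys = trans (length-++ (map (f x) ys))
      (cong₂ _+_ (length-map (f x) ys) (length-cartesianProductWith xs ys))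

    map-cartesianProductWith : ∀ {D : Set} (g : C → D) xs ys →
      map g (cartesianProductWith f xs ys) ≡ cartesianProductWith (λ x y → g (f x y)) xs ys
    map-cartesianProductWith g []       ys = refl
    map-cartesianProductWith g (x ∷ xs) ys = trans (map-++ g (map (f x) ys) _)
      (cong₂ _++_ (sym (map-∘ ys)) (map-cartesianProductWith g xs ys))

  allVec≡cartesianProductWith : ∀ n m → allVec (suc n) m ≡ cartesianProductWith _∷_ (allFin m) (allVec n m)
  allVec≡cartesianProductWith n m = concatMap-map≡cartesianProductWith _∷_ (allFin m) (allVec n m)

  allVec-complete : ∀ n m (v : Vec (Fin m) n) → v ∈ allVec n m
  allVec-complete zero    m []      = here refl
  allVec-complete (suc n) m (x ∷ v) rewrite allVec≡cartesianProductWith n m =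
    ∈-cartesianProductWith⁺ _∷_ (∈-allFin x) (allVec-complete n m v)

  allVec-unique : ∀ n m → Unique (allVec n m)
  allVec-unique zero    m = [] ∷ []
  allVec-unique (suc n) m rewrite allVec≡cartesianProductWith n m =
    Unique.cartesianProductWith⁺ _∷_ ∷-injective (Unique.allFin⁺ m) (allVec-unique n m)

  length-allVec : ∀ n m → length (allVec n m) ≡ m ^ n
  length-allVec zero    m = refl
  length-allVec (suc n) m rewrite allVec≡cartesianProductWith n m =
    trans (length-cartesianProductWith _∷_ (allFin m) (allVec n m))
          (cong₂ _*_ (length-tabulate {n = m} (λ k → k)) (length-allVec n m))

module FixedPoints where
  open import Defs using (count; iter)
  open Counting
  open import Data.Bool using (Bool; true; false; _∧_; not)
  open import Data.Bool.Properties using (∧-zeroʳ)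
  open import Data.List using (List; []; _∷_; applyUpTo)
  open import Data.List.Properties using (length-applyUpTo)
  open import Data.List.Membership.Propositional using (_∈_)
  open import Data.List.Membership.Propositional.Properties using (∈-applyUpTo⁺; ∈-applyUpTo⁻)
  open import Data.List.Membership.DecPropositional using () renaming (_∈?_ to ∈?)
  open import Data.List.Relation.Unary.All using (All; []; _∷_)
  open import Data.List.Relation.Unary.Any using (here; there)
  open import Data.List.Relation.Unary.Unique.Propositional using (Unique)
  import Data.List.Relation.Unary.Unique.Propositional.Properties as Unique
  open import Data.Nat using (ℕ; zero; suc; _+_; _*_; _∸_; _^_; _≤_; _<_; z≤n; s≤s; NonZero; pred)
  open import Data.Nat.Properties
  open import Data.Nat.DivMod using (_%_; _/_; m≡m%n+[m/n]*n; m%n<n)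
  open import Data.Nat.Divisibility using (_∣_; _∣0; n∣n; ∣m∣n⇒∣m+n)
  open import Data.Nat.Primality using (Prime; prime⇒nonZero)
  open import Data.Nat.Coprimality using (prime⇒coprime; coprime-Bézout)
  open import Data.Nat.GCD using (module Bézout)
  open import Data.Product using (∃; _×_; _,_; proj₁; proj₂)
  open import Function using (_⇔_; mk⇔)
  open import Relation.Binary.Definitions using (DecidableEquality)
  open import Relation.Binary.PropositionalEquality
  open import Relation.Nullary using (¬_; does; yes; no; contradiction)
  open import Relation.Nullary.Decidable using (dec-true; dec-false)
  open ≡-Reasoning

  module _ {A : Set} (f : A → A) where

    iter-+ : ∀ m n x → iter f (m + n) x ≡ iter f m (iter f n x)
    iter-+ zero    n x = refl
    iter-+ (suc m) n x = cong f (iter-+ m n x)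

    iter-sucʳ : ∀ n x → iter f (suc n) x ≡ iter f n (f x)
    iter-sucʳ zero    x = refl
    iter-sucʳ (suc n) x = cong f (iter-sucʳ n x)

    iter-periodic : ∀ {m x} → iter f m x ≡ x → ∀ k → iter f (k * m) x ≡ x
    iter-periodic         fix zero    = refl
    iter-periodic {m} {x} fix (suc k) =
      trans (iter-+ m (k * m) x) (trans (cong (iter f m) (iter-periodic fix k)) fix)

    iter-% : ∀ {m x} .{{_ : NonZero m}} → iter f m x ≡ x → ∀ n → iter f n x ≡ iter f (n % m) x
    iter-% {m} {x} fix n = begin
      iter f n x                                 ≡⟨ cong (λ k → iter f k x) (m≡m%n+[m/n]*n n m) ⟩
      iter f (n % m + (n / m) * m) x             ≡⟨ iter-+ (n % m) ((n / m) * m) x ⟩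
      iter f (n % m) (iter f ((n / m) * m) x)    ≡⟨ cong (iter f (n % m)) (iter-periodic fix (n / m)) ⟩
      iter f (n % m) x                           ∎

    iter-iter : ∀ m n x → iter (iter f m) n x ≡ iter f (n * m) x
    iter-iter m zero    x = refl
    iter-iter m (suc n) x = trans (cong (iter f m) (iter-iter m n x)) (sym (iter-+ m (n * m) x))

    fixed⇒iter-fixed : ∀ {x} → f x ≡ x → ∀ n → iter f n x ≡ x
    fixed⇒iter-fixed fix zero    = refl
    fixed⇒iter-fixed fix (suc n) = trans (cong f (fixed⇒iter-fixed fix n)) fix

  module _ {A : Set} where

    Invariant : (A → A) → (A → Bool) → Set
    Invariant f X = ∀ {x} → X x ≡ true → X (f x) ≡ true

    Periodic : ℕ → (A → A) → (A → Bool) → Set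
    Periodic n f X = ∀ {x} → X x ≡ true → iter f n x ≡ x

    FixedPointFree : (A → A) → (A → Bool) → Set
    FixedPointFree f X = ∀ {x} → X x ≡ true → f x ≢ x

    Commute : (A → A) → (A → A) → (A → Bool) → Set
    Commute f g X = ∀ {x} → X x ≡ true → f (g x) ≡ g (f x)

    iter-invariant : ∀ {f} X → Invariant f X → ∀ n → Invariant (iter f n) X
    iter-invariant X inv zero    Xx = Xx
    iter-invariant X inv (suc n) Xx = inv (iter-invariant X inv n Xx)

  module PrimePowerOrder {A : Set} (_≟_ : DecidableEquality A)
                    (L : List A) (L-complete : ∀ x → x ∈ L) (L-unique : Unique L)
                    {q : ℕ} (q-prime : Prime q) where

    open Enumeration L L-complete L-unique

    instance
      q≢0 : NonZero q
      q≢0 = prime⇒nonZero q-prime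

    Fixed : (A → A) → A → Bool
    Fixed f x = does (f x ≟ x)

    module _ {f : A → A} where

      prime-period⇒fixed : ∀ {y m} → iter f q y ≡ y → iter f m y ≡ y → 0 < m → m < q → f y ≡ y
      prime-period⇒fixed {y} {m@(suc _)} fix-q fix-m _ m<q with coprime-Bézout (prime⇒coprime q-prime m<q)
      ... | Bézout.+- a b eq = begin
        f y                   ≡⟨ cong f (iter-periodic f fix-m b) ⟨
        iter f (1 + b * m) y  ≡⟨ cong (λ k → iter f k y) eq ⟩
        iter f (a * q) y      ≡⟨ iter-periodic f fix-q a ⟩
        y                     ∎
      ... | Bézout.-+ a b eq = begin
        f y                   ≡⟨ cong f (iter-periodic f fix-q a) ⟨
        iter f (1 + a * q) y  ≡⟨ cong (λ k → iter f k y) eq ⟩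
        iter f (b * m) y      ≡⟨ iter-periodic f fix-m b ⟩
        y                     ∎

      orbit : A → List A
      orbit y = applyUpTo (λ k → iter f k y) q

      InOrbit : A → A → Bool
      InOrbit y x = does (∈? _≟_ x (orbit y))

      _∖orbit_ : (A → Bool) → A → A → Bool
      (X ∖orbit y) x = X x ∧ not (InOrbit y x)

      module _ {X : A → Bool} (inv : Invariant f X) (per : Periodic q f X) where

        iter-pred-q : ∀ {x} → X x ≡ true → iter f (pred q) (f x) ≡ x
        iter-pred-q {x} Xx = begin
          iter f (pred q) (f x)    ≡⟨ iter-sucʳ f (pred q) x ⟨
          iter f (suc (pred q)) x  ≡⟨ cong (λ n → iter f n x) (suc-pred q) ⟩
          iter f q x               ≡⟨ per Xx ⟩
          x                        ∎

        orbit-closed : ∀ {y} → X y ≡ true → ∀ n → iter f n y ∈ orbit y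
        orbit-closed {y} Xy n = subst (_∈ orbit y) (sym (iter-% f (per Xy) n)) (∈-applyUpTo⁺ _ (m%n<n n q))

        orbit⊆X : ∀ {y z} → X y ≡ true → z ∈ orbit y → X z ≡ true
        orbit⊆X Xy z∈ with k , _ , refl ← ∈-applyUpTo⁻ _ z∈ = iter-invariant X inv k Xy

        orbit-unique : ∀ {y} → FixedPointFree f X → X y ≡ true → Unique (orbit y)
        orbit-unique {y} free Xy = Unique.applyUpTo⁺₁ _ q distinct
          where
            distinct : ∀ {i j} → i < j → j < q → iter f i y ≢ iter f j y
            distinct {i} {j} i<j j<q fiy≡fjy = free (iter-invariant X inv i Xy)
              (prime-period⇒fixed (per (iter-invariant X inv i Xy)) returns (m<n⇒0<n∸m i<j) (≤-<-trans (m∸n≤m j i) j<q))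
              where
                returns : iter f (j ∸ i) (iter f i y) ≡ iter f i y
                returns = begin
                  iter f (j ∸ i) (iter f i y) ≡⟨ iter-+ f (j ∸ i) i y ⟨
                  iter f (j ∸ i + i) y        ≡⟨ cong (λ k → iter f k y) (m∸n+n≡m (<⇒≤ i<j)) ⟩
                  iter f j y                  ≡⟨ fiy≡fjy ⟨
                  iter f i y                  ∎

        outside-orbit-invariant : ∀ {y} → X y ≡ true → Invariant f (X ∖orbit y)
        outside-orbit-invariant {y} Xy {x} h with ∧-not-true⁻ h
        ... | Xx , x∉ with ∈? _≟_ (f x) (orbit y)
        ... | no  _   = cong₂ _∧_ (inv Xx) refl
        ... | yes fx∈ with k , _ , fx≡fᵏy ← ∈-applyUpTo⁻ _ fx∈ =
          contradiction (subst (_∈ orbit y) (sym x≡fᵖy) (orbit-closed Xy (pred q + k)))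
                        (does-false⁻ (∈? _≟_ x (orbit y)) x∉)
          where
            x≡fᵖy : x ≡ iter f (pred q + k) y
            x≡fᵖy = begin
              x                            ≡⟨ iter-pred-q Xx ⟨
              iter f (pred q) (f x)        ≡⟨ cong (iter f (pred q)) fx≡fᵏy ⟩
              iter f (pred q) (iter f k y) ≡⟨ iter-+ f (pred q) k y ⟨
              iter f (pred q + k) y        ∎

        count-outside-orbit : ∀ {y} → FixedPointFree f X → X y ≡ true →
          count X L ≡ q + count (X ∖orbit y) L
        count-outside-orbit {y} free Xy = trans (count-split X (InOrbit y) L)
          (cong (_+ count (X ∖orbit y) L) (trans (count≡length _ (orbit-unique free Xy) X∧InOrbit⇔) (length-applyUpTo _ q)))
          where
            X∧InOrbit⇔ : ∀ {x} → X x ∧ InOrbit y x ≡ true ⇔ x ∈ orbit y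
            X∧InOrbit⇔ {x} = mk⇔ (λ h → does-true⁻ (∈? _≟_ x (orbit y)) (proj₂ (∧-true⁻ h)))
                                 (λ x∈ → cong₂ _∧_ (orbit⊆X Xy x∈) (dec-true (∈? _≟_ x (orbit y)) x∈))

      fixed-point-free⇒q∣count : ∀ n {X} → count X L ≤ n →
        Invariant f X → Periodic q f X → FixedPointFree f X → q ∣ count X L
      fixed-point-free⇒q∣count n {X} bound inv per free with count X L in |X|
      ... | zero = q ∣0
      fixed-point-free⇒q∣count (suc n) {X} (s≤s bound) inv per free | suc c
        with y , Xy ← count>0⇒∃ X L (subst (0 <_) (sym |X|) (s≤s z≤n)) =
        subst (q ∣_) (trans (sym split) |X|) (∣m∣n⇒∣m+n n∣n (fixed-point-free⇒q∣count n bound′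
          (outside-orbit-invariant inv per Xy) (λ h → per (proj₁ (∧-not-true⁻ h))) (λ h → free (proj₁ (∧-not-true⁻ h)))))
        where
          split : count X L ≡ q + count (X ∖orbit y) L
          split = count-outside-orbit inv per free Xy
          c≡pred-q+rest : c ≡ pred q + count (X ∖orbit y) L
          c≡pred-q+rest = suc-injective (trans (sym |X|) (trans split (cong (_+ count (X ∖orbit y) L) (sym (suc-pred q)))))
          bound′ : count (X ∖orbit y) L ≤ n
          bound′ = ≤-trans (m≤n+m _ (pred q)) (subst (_≤ n) c≡pred-q+rest bound)

    ¬q∣count⇒∃ : ∀ {X : A → Bool} → ¬ q ∣ count X L → ∃ λ x → X x ≡ true
    ¬q∣count⇒∃ {X} q∤ with count X L in |X|
    ... | zero  = contradiction (q ∣0) q∤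
    ... | suc _ = count>0⇒∃ X L (subst (0 <_) (sym |X|) (s≤s z≤n))

    module _ {f : A → A} where

      ¬q∣count⇒¬q∣count-fixed : ∀ {X} → Invariant f X → Periodic q f X →
        ¬ q ∣ count X L → ¬ q ∣ count (λ x → X x ∧ Fixed f x) L
      ¬q∣count⇒¬q∣count-fixed {X} inv per q∤ q∣fixed =
        q∤ (subst (q ∣_) (sym (count-split X (Fixed f) L)) (∣m∣n⇒∣m+n q∣fixed q∣moving))
        where
          Moving : A → Bool
          Moving x = X x ∧ not (Fixed f x)
          moving-invariant : Invariant f Moving
          moving-invariant {x} h with Xx , unfixed ← ∧-not-true⁻ h =
            cong₂ _∧_ (inv Xx) (cong not (dec-false (f (f x) ≟ f x) fx-unfixed))
            where
              fx-unfixed : f (f x) ≢ f x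
              fx-unfixed ffx≡fx = does-false⁻ (f x ≟ x) unfixed
                (sym (trans (sym (iter-pred-q inv per Xx)) (fixed⇒iter-fixed f ffx≡fx (pred q))))
          q∣moving : q ∣ count Moving L
          q∣moving = fixed-point-free⇒q∣count (count Moving L) ≤-refl moving-invariant
            (λ h → per (proj₁ (∧-not-true⁻ h))) (λ {x} h → does-false⁻ (f x ≟ x) (proj₂ (∧-not-true⁻ h)))

    module _ {f : A → A} where

      ¬q∣count⇒¬q∣count-fixed-^ : ∀ s {X} → Invariant f X → Periodic (q ^ s) f X →
        ¬ q ∣ count X L → ¬ q ∣ count (λ x → X x ∧ Fixed f x) L
      ¬q∣count⇒¬q∣count-fixed-^ zero {X} inv per q∤ =
        subst (λ n → ¬ q ∣ n) (count-cong X≡X∧Fixed L) q∤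
        where
          X≡X∧Fixed : ∀ x → X x ≡ X x ∧ Fixed f x
          X≡X∧Fixed x with X x in Xx
          ... | true  = sym (dec-true (f x ≟ x) (per Xx))
          ... | false = refl
      ¬q∣count⇒¬q∣count-fixed-^ (suc s) {X} inv per q∤ =
        subst (λ n → ¬ q ∣ n) (count-cong drop-Fixed-g L)
          (¬q∣count⇒¬q∣count-fixed-^ s {X′} inv′ (λ h → does-true⁻ (g _ ≟ _) (proj₂ (∧-true⁻ h)))
            (¬q∣count⇒¬q∣count-fixed {f = g} (iter-invariant X inv (q ^ s)) (λ {x} Xx → trans (iter-iter f (q ^ s) q x) (per Xx)) q∤))
        where
          g : A → A
          g = iter f (q ^ s)
          X′ : A → Bool
          X′ x = X x ∧ Fixed g x
          inv′ : Invariant f X′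
          inv′ {x} h with Xx , gx≡x ← ∧-true⁻ h =
            cong₂ _∧_ (inv Xx) (dec-true (g (f x) ≟ f x)
              (trans (sym (iter-sucʳ f (q ^ s) x)) (cong f (does-true⁻ (g x ≟ x) gx≡x))))
          drop-Fixed-g : ∀ x → (X x ∧ Fixed g x) ∧ Fixed f x ≡ X x ∧ Fixed f x
          drop-Fixed-g x with X x | f x ≟ x
          ... | false | _        = refl
          ... | true  | no  _    = ∧-zeroʳ (Fixed g x)
          ... | true  | yes fx≡x = cong (_∧ true) (dec-true (g x ≟ x) (fixed⇒iter-fixed f fx≡x (q ^ s)))

    common-fixed-point : ∀ s {X} (fs : List (A → A)) →
      (∀ {f} → f ∈ fs → Invariant f X) → (∀ {f} → f ∈ fs → Periodic (q ^ s) f X) →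
      (∀ {f g} → f ∈ fs → g ∈ fs → Commute f g X) →
      ¬ q ∣ count X L → ∃ λ x → X x ≡ true × All (λ f → f x ≡ x) fs
    common-fixed-point s [] _ _ _ q∤ with x , Xx ← ¬q∣count⇒∃ q∤ = x , Xx , []
    common-fixed-point s {X} (f ∷ fs) inv per comm q∤ =
      extend (common-fixed-point s {X′} fs inv′ (λ g∈ X′x → per (there g∈) (X⇐X′ X′x))
               (λ g∈ h∈ X′x → comm (there g∈) (there h∈) (X⇐X′ X′x))
               (¬q∣count⇒¬q∣count-fixed-^ s (inv (here refl)) (per (here refl)) q∤))
      where
        X′ : A → Bool
        X′ x = X x ∧ Fixed f x
        X⇐X′ : ∀ {x} → X′ x ≡ true → X x ≡ true
        X⇐X′ X′x = proj₁ (∧-true⁻ X′x)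
        inv′ : ∀ {g} → g ∈ fs → Invariant g X′
        inv′ {g} g∈ {x} X′x with Xx , fx≡x ← ∧-true⁻ X′x = cong₂ _∧_ (inv (there g∈) Xx)
          (dec-true (f (g x) ≟ g x) (trans (comm (here refl) (there g∈) Xx) (cong g (does-true⁻ (f x ≟ x) fx≡x))))
        extend : (∃ λ x → X′ x ≡ true × All (λ g → g x ≡ x) fs) → ∃ λ x → X x ≡ true × All (λ g → g x ≡ x) (f ∷ fs)
        extend (x , X′x , fixes) = x , X⇐X′ X′x , does-true⁻ (f x ≟ x) (proj₂ (∧-true⁻ X′x)) ∷ fixes

module TransitiveMaps where
  open import Defs using (iter)
  open FixedPoints using (iter-+; iter-sucʳ; iter-periodic; iter-%)
  open import Data.Fin using (Fin; toℕ; fromℕ<)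
  open import Data.Fin.Properties using (pigeonhole; injective⇒≤; toℕ-fromℕ<; toℕ<n)
  import Data.Fin
  open import Data.Nat using (ℕ; zero; suc; _+_; _*_; _∸_; _<_; NonZero; >-nonZero)
  open import Data.Nat.Properties
  open import Data.Nat.DivMod using (_%_; m%n<n)
  open import Data.Nat.Coprimality using (Coprime; coprime-Bézout)
  open import Data.Nat.GCD using (module Bézout)
  open import Data.Product using (∃; ∃₂; _×_; _,_; proj₁)
  open import Relation.Binary.PropositionalEquality
  open ≡-Reasoning

  module _ {A : Set} where

    Transitive : (A → A) → Set
    Transitive f = ∀ i j → ∃ λ k → iter f k i ≡ j

    iter-cong : ∀ {f g : A → A} → (∀ x → f x ≡ g x) → ∀ n x → iter f n x ≡ iter g n x
    iter-cong f≗g zero    x = refl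
    iter-cong {g = g} f≗g (suc n) x = trans (f≗g _) (cong g (iter-cong f≗g n x))

    Transitive-cong : ∀ {f g : A → A} → (∀ x → f x ≡ g x) → Transitive f → Transitive g
    Transitive-cong f≗g f-transitive i j =
      let k , fᵏi≡j = f-transitive i j in k , trans (sym (iter-cong f≗g k i)) fᵏi≡j

    left-inverse-transitive : ∀ {f g : A → A} → (∀ x → g (f x) ≡ x) → Transitive f → Transitive g
    left-inverse-transitive {f} {g} g∘f≗id f-transitive i j =
      let k , fᵏj≡i = f-transitive j i in k , trans (cong (iter g k) (sym fᵏj≡i)) (undo k j)
      where
        undo : ∀ k x → iter g k (iter f k x) ≡ x
        undo zero    x = refl
        undo (suc k) x = begin
          g (iter g k (f (iter f k x)))  ≡⟨ cong (λ y → g (iter g k y)) (iter-sucʳ f k x) ⟩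
          g (iter g k (iter f k (f x)))  ≡⟨ cong g (undo k (f x)) ⟩
          g (f x)                        ≡⟨ g∘f≗id x ⟩
          x                              ∎

    transitive⇒periodic : ∀ {f : A → A} {e y} → Transitive f → iter f e y ≡ y → ∀ z → iter f e z ≡ z
    transitive⇒periodic {f} {e} {y} f-transitive y-periodic z = let k , fᵏy≡z = f-transitive y z in begin
      iter f e z                    ≡⟨ cong (iter f e) fᵏy≡z ⟨
      iter f e (iter f k y)         ≡⟨ iter-+ f e k y ⟨
      iter f (e + k) y              ≡⟨ cong (λ m → iter f m y) (+-comm e k) ⟩
      iter f (k + e) y              ≡⟨ iter-+ f k e y ⟩
      iter f k (iter f e y)         ≡⟨ cong (iter f k) y-periodic ⟩
      iter f k y                    ≡⟨ fᵏy≡z ⟩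
      z                             ∎

    conjugate-transitive : ∀ {f g h : A → A} → (∀ a → f (g a) ≡ a) → (∀ a → g (f a) ≡ a) →
      Transitive h → Transitive (λ a → g (h (f a)))
    conjugate-transitive {f} {g} {h} f∘g≗id g∘f≗id h-transitive i j =
      let k , hᵏfi≡fj = h-transitive (f i) (f j) in k , trans (iter-conj k i) (trans (cong g hᵏfi≡fj) (g∘f≗id j))
      where
        iter-conj : ∀ k a → iter (λ a → g (h (f a))) k a ≡ g (iter h k (f a))
        iter-conj zero    a = sym (g∘f≗id a)
        iter-conj (suc k) a = trans (cong (λ b → g (h (f b))) (iter-conj k a)) (cong (λ b → g (h b)) (f∘g≗id _))

  transitive⇒n≤period : ∀ {n} {f : Fin n → Fin n} {e y} .{{_ : NonZero e}} → Transitive f → iter f e y ≡ y → n ≤ e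
  transitive⇒n≤period {n} {f} {e} {y} f-transitive y-periodic = injective⇒≤ position-injective
    where
      position : Fin n → Fin e
      position z = fromℕ< (m%n<n (proj₁ (f-transitive y z)) e)
      position-correct : ∀ z → iter f (toℕ (position z)) y ≡ z
      position-correct z = let k , fᵏy≡z = f-transitive y z in begin
        iter f (toℕ (position z)) y   ≡⟨ cong (λ m → iter f m y) (toℕ-fromℕ< (m%n<n k e)) ⟩
        iter f (k % e) y              ≡⟨ iter-% f y-periodic k ⟨
        iter f k y                    ≡⟨ fᵏy≡z ⟩
        z                             ∎
      position-injective : ∀ {z z′} → position z ≡ position z′ → z ≡ z′
      position-injective {z} {z′} same =
        trans (sym (position-correct z)) (trans (cong (λ p → iter f (toℕ p) y) same) (position-correct z′))

  transitive⇒iter-n≡id : ∀ {n} {f : Fin n → Fin n} → Transitive f → ∀ j → iter f n j ≡ j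
  transitive⇒iter-n≡id {n} {f} f-transitive j = from-collision (pigeonhole (n<1+n n) (λ k → iter f (toℕ k) j))
    where
      from-collision : (∃₂ λ a b → a Data.Fin.< b × iter f (toℕ a) j ≡ iter f (toℕ b) j) → iter f n j ≡ j
      from-collision (a , b , a<b , fᵃj≡fᵇj) =
        subst (λ m → iter f m j ≡ j) e≡n (transitive⇒periodic {e = e} f-transitive y-periodic j)
        where
          e : ℕ
          e = toℕ b ∸ toℕ a
          instance
            e≢0 : NonZero e
            e≢0 = >-nonZero (m<n⇒0<n∸m a<b)
          y-periodic : iter f e (iter f (toℕ a) j) ≡ iter f (toℕ a) j
          y-periodic = begin
            iter f e (iter f (toℕ a) j)   ≡⟨ iter-+ f e (toℕ a) j ⟨
            iter f (e + toℕ a) j          ≡⟨ cong (λ m → iter f m j) (m∸n+n≡m (<⇒≤ a<b)) ⟩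
            iter f (toℕ b) j              ≡⟨ fᵃj≡fᵇj ⟨
            iter f (toℕ a) j              ∎
          e≡n : e ≡ n
          e≡n = ≤-antisym (≤-trans (m∸n≤m (toℕ b) (toℕ a)) (≤-pred (toℕ<n b))) (transitive⇒n≤period {e = e} f-transitive y-periodic)

  coprime-iterate-transitive : ∀ {n} {f : Fin n → Fin n} → Transitive f → ∀ {u} → Coprime u n →
    ∃ λ x → Transitive (iter f (x * u))
  coprime-iterate-transitive {n} {f} f-transitive {u} u⊥n with coprime-Bézout u⊥n
  ... | Bézout.+- x y 1+yn≡xu = x , Transitive-cong f≗fˣᵘ f-transitive
    where
      f≗fˣᵘ : ∀ z → f z ≡ iter f (x * u) z
      f≗fˣᵘ z = begin
        f z                    ≡⟨ cong f (iter-periodic f (transitive⇒iter-n≡id f-transitive z) y) ⟨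
        iter f (1 + y * n) z   ≡⟨ cong (λ m → iter f m z) 1+yn≡xu ⟩
        iter f (x * u) z       ∎
  ... | Bézout.-+ x y 1+xu≡yn = x , left-inverse-transitive fˣᵘ∘f≗id f-transitive
    where
      fˣᵘ∘f≗id : ∀ z → iter f (x * u) (f z) ≡ z
      fˣᵘ∘f≗id z = begin
        iter f (x * u) (f z)   ≡⟨ iter-sucʳ f (x * u) z ⟨
        iter f (1 + x * u) z   ≡⟨ cong (λ m → iter f m z) 1+xu≡yn ⟩
        iter f (y * n) z       ≡⟨ iter-periodic f (transitive⇒iter-n≡id f-transitive z) y ⟩
        z                      ∎

module PrimePowers {q : ℕ} (q-prime : Prime q) where
  open import Data.Nat using (ℕ; zero; suc; _*_; _^_; _<_; z≤n; s≤s; nonTrivial⇒n>1)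
  open import Data.Nat.Properties
  open import Data.Nat.Divisibility using (_∣_; _∣?_; divides; ∣-trans; ∣1⇒≡1)
  open import Data.Nat.Primality using (Prime; prime⇒irreducible; prime⇒nonTrivial)
  open import Data.Nat.Coprimality using (Coprime; coprime-divisor)
  open import Data.Nat.Induction using (<-wellFounded)
  open import Induction.WellFounded using (Acc; acc)
  open import Data.Product using (∃₂; _×_; _,_)
  open import Data.Sum using (inj₁; inj₂)
  open import Relation.Binary.PropositionalEquality
  open import Relation.Nullary using (¬_; yes; no; contradiction)
  open ≡-Reasoning

  ∤⇒coprime-^ : ∀ {u} → ¬ q ∣ u → ∀ r → Coprime u (q ^ r)
  ∤⇒coprime-^ q∤u zero    (_ , i∣1) = ∣1⇒≡1 i∣1
  ∤⇒coprime-^ q∤u (suc r) {i} (i∣u , i∣qqʳ) = ∤⇒coprime-^ q∤u r (i∣u , coprime-divisor i⊥q i∣qqʳ)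
    where
      i⊥q : Coprime i q
      i⊥q {c} (c∣i , c∣q) with prime⇒irreducible q-prime c∣q
      ... | inj₁ c≡1    = c≡1
      ... | inj₂ refl   = contradiction (∣-trans c∣i i∣u) q∤u

  q-adic-decomposition : ∀ N → 0 < N → ∃₂ λ s u → N ≡ q ^ s * u × ¬ q ∣ u
  q-adic-decomposition N = go N (<-wellFounded N)
    where
      go : ∀ N → Acc _<_ N → 0 < N → ∃₂ λ s u → N ≡ q ^ s * u × ¬ q ∣ u
      go N (acc smaller) N>0 with q ∣? N
      ... | no  q∤N = 0 , N , sym (*-identityˡ N) , q∤N
      ... | yes (divides zero N≡0) = contradiction (sym N≡0) (<⇒≢ N>0)
      ... | yes (divides k@(suc _) N≡kq) =
        let s , u , k≡qˢu , q∤u = go k (smaller k<N) (s≤s z≤n) in suc s , u , N≡qˢ⁺¹u {s} k≡qˢu , q∤u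
        where
          k<N : k < N
          k<N = subst (k <_) (sym N≡kq) (m<m*n k q (nonTrivial⇒n>1 q {{prime⇒nonTrivial q-prime}}))
          N≡qˢ⁺¹u : ∀ {s u} → k ≡ q ^ s * u → N ≡ q ^ suc s * u
          N≡qˢ⁺¹u {s} {u} k≡qˢu = begin
            N                ≡⟨ N≡kq ⟩
            k * q            ≡⟨ cong (_* q) k≡qˢu ⟩
            (q ^ s * u) * q  ≡⟨ *-comm (q ^ s * u) q ⟩
            q * (q ^ s * u)  ≡⟨ *-assoc q (q ^ s) u ⟨
            q ^ suc s * u    ∎

module WreathProduct (q : ℕ) .{{q≢0 : NonZero q}} (d : ℕ) where
  open import Defs using (module Wr; iter)
  open Wr q d
  open import Data.Nat using (zero; suc; _+_; _*_; _∸_)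
  open import Data.Nat.Properties
  open import Data.Nat.DivMod using (_%_; _mod_; %-congˡ; %-distribˡ-+; %-distribˡ-*; m%n%n≡m%n; m<n⇒m%n≡m; m%n<n; [m+kn]%n≡m%n; [m+n]%n≡m%n)
  open import Data.Fin using (Fin; toℕ)
  open import Data.Fin.Properties using (toℕ-fromℕ<; toℕ-injective; toℕ<n)
  open import Data.Vec using (Vec; lookup; tabulate)
  open import Data.Vec.Properties using (lookup∘tabulate; tabulate∘lookup; tabulate-cong)
  open import Data.Product using (_,_; proj₁; proj₂)
  open import Data.Bool using (true; _∧_)
  import Data.Fin as Fin
  open import Data.Vec.Properties using (≡-dec)
  open import Relation.Nullary using (Dec)
  open import Relation.Nullary.Decidable using (isYes; isYes≗does; dec-true)
  open Counting using (∧-true⁻; does-true⁻)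
  open TransitiveMaps using (Transitive-cong; conjugate-transitive)
  open import Algebra.Bundles using (Monoid)
  open import Level using (0ℓ)
  open import Relation.Binary.PropositionalEquality hiding ([_])
  open ≡-Reasoning

  -- x +F y is literally [ toℕ x + toℕ y ], so the absorption lemmas below reduce every
  -- field law to the corresponding law of ℕ.
  [_] : ℕ → Fin q
  [ n ] = n mod q

  toℕ-[] : ∀ n → toℕ [ n ] ≡ n % q
  toℕ-[] n = toℕ-fromℕ< (m%n<n n q)

  [toℕ] : ∀ x → [ toℕ x ] ≡ x
  [toℕ] x = toℕ-injective (trans (toℕ-[] (toℕ x)) (m<n⇒m%n≡m (toℕ<n x)))

  []-cong-% : ∀ {m n} → m % q ≡ n % q → [ m ] ≡ [ n ]
  []-cong-% {m} {n} m≡n = toℕ-injective (trans (toℕ-[] m) (trans m≡n (sym (toℕ-[] n))))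

  []-absorbˡ-+ : ∀ m n → [ toℕ [ m ] + n ] ≡ [ m + n ]
  []-absorbˡ-+ m n = []-cong-% (begin
    (toℕ [ m ] + n) % q            ≡⟨ %-congˡ (cong (_+ n) (toℕ-[] m)) ⟩
    (m % q + n) % q                ≡⟨ %-distribˡ-+ (m % q) n q ⟩
    (m % q % q + n % q) % q        ≡⟨ %-congˡ (cong (_+ n % q) (m%n%n≡m%n m q)) ⟩
    (m % q + n % q) % q            ≡⟨ %-distribˡ-+ m n q ⟨
    (m + n) % q                    ∎)

  []-absorbʳ-+ : ∀ m n → [ m + toℕ [ n ] ] ≡ [ m + n ]
  []-absorbʳ-+ m n = begin
    [ m + toℕ [ n ] ] ≡⟨ cong [_] (+-comm m _) ⟩
    [ toℕ [ n ] + m ] ≡⟨ []-absorbˡ-+ n m ⟩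
    [ n + m ]         ≡⟨ cong [_] (+-comm n m) ⟩
    [ m + n ]         ∎

  []-absorbˡ-* : ∀ m n → [ toℕ [ m ] * n ] ≡ [ m * n ]
  []-absorbˡ-* m n = []-cong-% (begin
    (toℕ [ m ] * n) % q            ≡⟨ %-congˡ (cong (_* n) (toℕ-[] m)) ⟩
    (m % q * n) % q                ≡⟨ %-distribˡ-* (m % q) n q ⟩
    (m % q % q * (n % q)) % q      ≡⟨ %-congˡ (cong (_* (n % q)) (m%n%n≡m%n m q)) ⟩
    (m % q * (n % q)) % q          ≡⟨ %-distribˡ-* m n q ⟨
    (m * n) % q                    ∎)

  []-absorbʳ-* : ∀ m n → [ m * toℕ [ n ] ] ≡ [ m * n ]
  []-absorbʳ-* m n = begin
    [ m * toℕ [ n ] ] ≡⟨ cong [_] (*-comm m _) ⟩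
    [ toℕ [ n ] * m ] ≡⟨ []-absorbˡ-* n m ⟩
    [ n * m ]         ≡⟨ cong [_] (*-comm n m) ⟩
    [ m * n ]         ∎

  +F-comm : ∀ x y → x +F y ≡ y +F x
  +F-comm x y = cong [_] (+-comm (toℕ x) (toℕ y))

  +F-assoc : ∀ x y z → (x +F y) +F z ≡ x +F (y +F z)
  +F-assoc x y z = begin
    [ toℕ [ toℕ x + toℕ y ] + toℕ z ] ≡⟨ []-absorbˡ-+ (toℕ x + toℕ y) (toℕ z) ⟩
    [ toℕ x + toℕ y + toℕ z ]         ≡⟨ cong [_] (+-assoc (toℕ x) (toℕ y) (toℕ z)) ⟩
    [ toℕ x + (toℕ y + toℕ z) ]       ≡⟨ []-absorbʳ-+ (toℕ x) (toℕ y + toℕ z) ⟨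
    [ toℕ x + toℕ [ toℕ y + toℕ z ] ] ∎

  +F-identityˡ : ∀ x → 0F +F x ≡ x
  +F-identityˡ x = trans ([]-absorbˡ-+ 0 (toℕ x)) ([toℕ] x)

  +F-identityʳ : ∀ x → x +F 0F ≡ x
  +F-identityʳ x = trans (+F-comm x 0F) (+F-identityˡ x)

  *F-assoc : ∀ x y z → (x *F y) *F z ≡ x *F (y *F z)
  *F-assoc x y z = begin
    [ toℕ [ toℕ x * toℕ y ] * toℕ z ] ≡⟨ []-absorbˡ-* (toℕ x * toℕ y) (toℕ z) ⟩
    [ toℕ x * toℕ y * toℕ z ]         ≡⟨ cong [_] (*-assoc (toℕ x) (toℕ y) (toℕ z)) ⟩
    [ toℕ x * (toℕ y * toℕ z) ]       ≡⟨ []-absorbʳ-* (toℕ x) (toℕ y * toℕ z) ⟨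
    [ toℕ x * toℕ [ toℕ y * toℕ z ] ] ∎

  *F-identityˡ : ∀ x → 1F *F x ≡ x
  *F-identityˡ x = trans ([]-absorbˡ-* 1 (toℕ x)) (trans (cong [_] (*-identityˡ (toℕ x))) ([toℕ] x))

  *F-identityʳ : ∀ x → x *F 1F ≡ x
  *F-identityʳ x = trans (cong [_] (*-comm (toℕ x) _)) (*F-identityˡ x)

  *F-zeroʳ : ∀ x → x *F 0F ≡ 0F
  *F-zeroʳ x = trans ([]-absorbʳ-* (toℕ x) 0) (cong [_] (*-zeroʳ (toℕ x)))

  *F-distribˡ-+F : ∀ x y z → x *F (y +F z) ≡ (x *F y) +F (x *F z)
  *F-distribˡ-+F x y z = begin
    [ toℕ x * toℕ [ toℕ y + toℕ z ] ]                   ≡⟨ []-absorbʳ-* (toℕ x) (toℕ y + toℕ z) ⟩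
    [ toℕ x * (toℕ y + toℕ z) ]                         ≡⟨ cong [_] (*-distribˡ-+ (toℕ x) (toℕ y) (toℕ z)) ⟩
    [ toℕ x * toℕ y + toℕ x * toℕ z ]                   ≡⟨ []-absorbˡ-+ (toℕ x * toℕ y) (toℕ x * toℕ z) ⟨
    [ toℕ [ toℕ x * toℕ y ] + toℕ x * toℕ z ]           ≡⟨ []-absorbʳ-+ (toℕ [ toℕ x * toℕ y ]) (toℕ x * toℕ z) ⟨
    [ toℕ [ toℕ x * toℕ y ] + toℕ [ toℕ x * toℕ z ] ]   ∎

  -F_ : Fin q → Fin q
  -F x = [ q ∸ toℕ x ]

  -F-inverseˡ : ∀ x → (-F x) +F x ≡ 0F
  -F-inverseˡ x = begin
    [ toℕ [ q ∸ toℕ x ] + toℕ x ] ≡⟨ []-absorbˡ-+ (q ∸ toℕ x) (toℕ x) ⟩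
    [ q ∸ toℕ x + toℕ x ]         ≡⟨ cong [_] (m∸n+n≡m (<⇒≤ (toℕ<n x))) ⟩
    [ q ]                         ≡⟨ []-cong-% ([m+n]%n≡m%n 0 q) ⟩
    [ 0 ]                         ∎

  +F-cancelˡ : ∀ x {y z} → x +F y ≡ x +F z → y ≡ z
  +F-cancelˡ x {y} {z} x+y≡x+z = begin
    y                     ≡⟨ +F-identityˡ y ⟨
    0F +F y               ≡⟨ cong (_+F y) (-F-inverseˡ x) ⟨
    ((-F x) +F x) +F y    ≡⟨ +F-assoc (-F x) x y ⟩
    (-F x) +F (x +F y)    ≡⟨ cong ((-F x) +F_) x+y≡x+z ⟩
    (-F x) +F (x +F z)    ≡⟨ +F-assoc (-F x) x z ⟨
    ((-F x) +F x) +F z    ≡⟨ cong (_+F z) (-F-inverseˡ x) ⟩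
    0F +F z               ≡⟨ +F-identityˡ z ⟩
    z                     ∎

  π[_] : Raw → Fin d → Fin d
  π[ x ] = lookup (proj₁ x)

  a[_] : Raw → Fin d → Fin q
  a[ x ] = lookup (proj₁ (proj₂ x))

  b[_] : Raw → Fin d → Fin q
  b[ x ] = lookup (proj₂ (proj₂ x))

  π-· : ∀ x y i → π[ x · y ] i ≡ π[ x ] (π[ y ] i)
  π-· _ _ i = lookup∘tabulate _ i

  a-· : ∀ x y i → a[ x · y ] i ≡ a[ x ] (π[ y ] i) *F a[ y ] i
  a-· _ _ i = lookup∘tabulate _ i

  b-· : ∀ x y i → b[ x · y ] i ≡ (a[ x ] (π[ y ] i) *F b[ y ] i) +F b[ x ] (π[ y ] i)
  b-· _ _ i = lookup∘tabulate _ i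

  π-one : ∀ i → π[ one ] i ≡ i
  π-one i = lookup∘tabulate _ i

  a-one : ∀ i → a[ one ] i ≡ 1F
  a-one i = lookup∘tabulate _ i

  b-one : ∀ i → b[ one ] i ≡ 0F
  b-one i = lookup∘tabulate _ i

  vec-ext : ∀ {A : Set} {n} {u v : Vec A n} → (∀ i → lookup u i ≡ lookup v i) → u ≡ v
  vec-ext {u = u} {v} u≗v = trans (sym (tabulate∘lookup u)) (trans (tabulate-cong u≗v) (tabulate∘lookup v))

  Raw-ext : ∀ {x y} → (∀ i → π[ x ] i ≡ π[ y ] i) → (∀ i → a[ x ] i ≡ a[ y ] i) → (∀ i → b[ x ] i ≡ b[ y ] i) → x ≡ y
  Raw-ext {_ , _ , _} {_ , _ , _} π≗ a≗ b≗ = cong₂ _,_ (vec-ext π≗) (cong₂ _,_ (vec-ext a≗) (vec-ext b≗))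

  ·-assoc : ∀ x y z → (x · y) · z ≡ x · (y · z)
  ·-assoc x y z = Raw-ext π≗ a≗ b≗
    where
      π≗ : ∀ i → π[ (x · y) · z ] i ≡ π[ x · (y · z) ] i
      π≗ i = begin
        π[ (x · y) · z ] i        ≡⟨ π-· (x · y) z i ⟩
        π[ x · y ] (π[ z ] i)     ≡⟨ π-· x y _ ⟩
        π[ x ] (π[ y ] (π[ z ] i)) ≡⟨ cong π[ x ] (π-· y z i) ⟨
        π[ x ] (π[ y · z ] i)     ≡⟨ π-· x (y · z) i ⟨
        π[ x · (y · z) ] i        ∎
      a≗ : ∀ i → a[ (x · y) · z ] i ≡ a[ x · (y · z) ] i
      a≗ i = begin
        a[ (x · y) · z ] i                                      ≡⟨ a-· (x · y) z i ⟩
        a[ x · y ] (π[ z ] i) *F a[ z ] i                       ≡⟨ cong (_*F a[ z ] i) (a-· x y _) ⟩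
        (a[ x ] (π[ y ] (π[ z ] i)) *F a[ y ] (π[ z ] i)) *F a[ z ] i
                                                                ≡⟨ *F-assoc (a[ x ] (π[ y ] (π[ z ] i))) (a[ y ] (π[ z ] i)) (a[ z ] i) ⟩
        a[ x ] (π[ y ] (π[ z ] i)) *F (a[ y ] (π[ z ] i) *F a[ z ] i)
                                                                ≡⟨ cong₂ _*F_ (cong a[ x ] (π-· y z i)) (a-· y z i) ⟨
        a[ x ] (π[ y · z ] i) *F a[ y · z ] i                   ≡⟨ a-· x (y · z) i ⟨
        a[ x · (y · z) ] i                                      ∎
      b≗ : ∀ i → b[ (x · y) · z ] i ≡ b[ x · (y · z) ] i
      b≗ i = begin
        b[ (x · y) · z ] i                                 ≡⟨ b-· (x · y) z i ⟩
        (a[ x · y ] j *F b[ z ] i) +F b[ x · y ] j         ≡⟨ cong₂ (λ s t → (s *F b[ z ] i) +F t) (a-· x y j) (b-· x y j) ⟩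
        ((a₀ *F a₁) *F b[ z ] i) +F ((a₀ *F b₁) +F b₀)     ≡⟨ +F-assoc _ _ _ ⟨
        (((a₀ *F a₁) *F b[ z ] i) +F (a₀ *F b₁)) +F b₀     ≡⟨ cong (λ s → (s +F (a₀ *F b₁)) +F b₀) (*F-assoc a₀ a₁ (b[ z ] i)) ⟩
        ((a₀ *F (a₁ *F b[ z ] i)) +F (a₀ *F b₁)) +F b₀     ≡⟨ cong (_+F b₀) (*F-distribˡ-+F a₀ _ b₁) ⟨
        (a₀ *F ((a₁ *F b[ z ] i) +F b₁)) +F b₀             ≡⟨ cong₂ (λ k s → (a[ x ] k *F s) +F b[ x ] k) (π-· y z i) (b-· y z i) ⟨
        (a[ x ] (π[ y · z ] i) *F b[ y · z ] i) +F b[ x ] (π[ y · z ] i)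
                                                           ≡⟨ b-· x (y · z) i ⟨
        b[ x · (y · z) ] i                                 ∎
        where
          j  = π[ z ] i
          a₀ = a[ x ] (π[ y ] j)
          a₁ = a[ y ] j
          b₀ = b[ x ] (π[ y ] j)
          b₁ = b[ y ] j

  ·-identityˡ : ∀ x → one · x ≡ x
  ·-identityˡ x = Raw-ext
    (λ i → trans (π-· one x i) (π-one _))
    (λ i → trans (a-· one x i) (trans (cong (_*F a[ x ] i) (a-one _)) (*F-identityˡ _)))
    (λ i → trans (b-· one x i) (trans (cong₂ (λ s t → (s *F b[ x ] i) +F t) (a-one _) (b-one _))
                                      (trans (+F-identityʳ _) (*F-identityˡ _))))

  ·-identityʳ : ∀ x → x · one ≡ x
  ·-identityʳ x = Raw-ext
    (λ i → trans (π-· x one i) (cong π[ x ] (π-one i)))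
    (λ i → trans (a-· x one i) (trans (cong₂ _*F_ (cong a[ x ] (π-one i)) (a-one i)) (*F-identityʳ _)))
    (λ i → trans (b-· x one i) (trans (cong₂ (λ s t → (a[ x ] s *F t) +F b[ x ] s) (π-one i) (b-one i))
                                      (trans (cong (_+F b[ x ] i) (*F-zeroʳ (a[ x ] i))) (+F-identityˡ (b[ x ] i)))))

  monoid : Monoid 0ℓ 0ℓ
  monoid = record
    { Carrier  = Raw
    ; _≈_      = _≡_
    ; _∙_      = _·_
    ; ε        = one
    ; isMonoid = record
      { isSemigroup = record
        { isMagma = record { isEquivalence = isEquivalence ; ∙-cong = cong₂ _·_ }
        ; assoc   = ·-assoc }
      ; identity = ·-identityˡ , ·-identityʳ } }

  open import Algebra.Properties.Monoid.Mult monoid using (×-homo-+; ×-assocˡ) renaming (_×_ to _×ᴹ_)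

  pow : Raw → ℕ → Raw
  pow x n = n ×ᴹ x

  pow-+ : ∀ x m n → pow x (m + n) ≡ pow x m · pow x n
  pow-+ = ×-homo-+

  pow-pow : ∀ x m n → pow (pow x n) m ≡ pow x (m * n)
  pow-pow = ×-assocˡ

  pow-one : ∀ n → pow one n ≡ one
  pow-one zero    = refl
  pow-one (suc n) = trans (·-identityˡ (pow one n)) (pow-one n)

  π-pow : ∀ x n i → π[ pow x n ] i ≡ iter π[ x ] n i
  π-pow x zero    i = π-one i
  π-pow x (suc n) i = trans (π-· x (pow x n) i) (cong π[ x ] (π-pow x n i))

  record Translation (x : Raw) : Set where
    field
      π≗id : ∀ i → π[ x ] i ≡ i
      a≗1  : ∀ i → a[ x ] i ≡ 1F
  open Translation

  inCqd⇒Translation : ∀ {x} → x ∈ inCqd → Translation x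
  inCqd⇒Translation {π , a , b} x∈ with π∈ , a∈ ← ∧-true⁻ x∈ = record
    { π≗id = λ i → trans (cong (λ v → lookup v i) (isYes-true⁻ (≡-dec Fin._≟_ π _) π∈)) (lookup∘tabulate _ i)
    ; a≗1  = λ i → trans (cong (λ v → lookup v i) (isYes-true⁻ (≡-dec Fin._≟_ a _) a∈)) (lookup∘tabulate _ i) }
    where
      isYes-true⁻ : ∀ {P : Set} (P? : Dec P) → isYes P? ≡ true → P
      isYes-true⁻ P? h = does-true⁻ P? (trans (sym (isYes≗does P?)) h)

  ∩inCqd⇒Translation : ∀ {H x} → x ∈ (H ∩ inCqd) → Translation x
  ∩inCqd⇒Translation {H} {x} x∈ = inCqd⇒Translation (proj₂ (∧-true⁻ {H x} x∈))

  Translation⇒inCqd : ∀ {x} → Translation x → x ∈ inCqd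
  Translation⇒inCqd {π , a , b} t = cong₂ _∧_
    (isYes-true⁺ (≡-dec Fin._≟_ π _) (vec-ext (λ i → trans (π≗id t i) (sym (lookup∘tabulate _ i)))))
    (isYes-true⁺ (≡-dec Fin._≟_ a _) (vec-ext (λ i → trans (a≗1 t i) (sym (lookup∘tabulate _ i)))))
    where
      isYes-true⁺ : ∀ {P : Set} (P? : Dec P) → P → isYes P? ≡ true
      isYes-true⁺ P? p = trans (isYes≗does P?) (dec-true P? p)

  module _ {x : Raw} (tx : Translation x) (y : Raw) where

    π-translation-· : ∀ i → π[ x · y ] i ≡ π[ y ] i
    π-translation-· i = trans (π-· x y i) (π≗id tx _)

    a-translation-· : ∀ i → a[ x · y ] i ≡ a[ y ] i
    a-translation-· i = trans (a-· x y i) (trans (cong (_*F a[ y ] i) (a≗1 tx _)) (*F-identityˡ _))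

    π-·-translation : ∀ i → π[ y · x ] i ≡ π[ y ] i
    π-·-translation i = trans (π-· y x i) (cong π[ y ] (π≗id tx i))

    a-·-translation : ∀ i → a[ y · x ] i ≡ a[ y ] i
    a-·-translation i = trans (a-· y x i) (trans (cong₂ _*F_ (cong a[ y ] (π≗id tx i)) (a≗1 tx i)) (*F-identityʳ _))

  Translation-one : Translation one
  Translation-one = record { π≗id = π-one ; a≗1 = a-one }

  Translation-· : ∀ {x y} → Translation x → Translation y → Translation (x · y)
  Translation-· {y = y} tx ty = record
    { π≗id = λ i → trans (π-translation-· tx y i) (π≗id ty i)
    ; a≗1  = λ i → trans (a-translation-· tx y i) (a≗1 ty i) }

  b-translation-· : ∀ {x y} → Translation x → Translation y → ∀ i → b[ x · y ] i ≡ b[ y ] i +F b[ x ] i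
  b-translation-· {x} {y} tx ty i = begin
    b[ x · y ] i                                     ≡⟨ b-· x y i ⟩
    (a[ x ] (π[ y ] i) *F b[ y ] i) +F b[ x ] (π[ y ] i) ≡⟨ cong₂ (λ s j → (s *F b[ y ] i) +F b[ x ] j) (a≗1 tx _) (π≗id ty i) ⟩
    (1F *F b[ y ] i) +F b[ x ] i                     ≡⟨ cong (_+F b[ x ] i) (*F-identityˡ (b[ y ] i)) ⟩
    b[ y ] i +F b[ x ] i                             ∎

  Translation-ext : ∀ {x y} → Translation x → Translation y → (∀ i → b[ x ] i ≡ b[ y ] i) → x ≡ y
  Translation-ext tx ty = Raw-ext (λ i → trans (π≗id tx i) (sym (π≗id ty i))) (λ i → trans (a≗1 tx i) (sym (a≗1 ty i)))

  translations-commute : ∀ {x y} → Translation x → Translation y → x · y ≡ y · x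
  translations-commute {x} {y} tx ty = Translation-ext (Translation-· tx ty) (Translation-· ty tx) (λ i → begin
    b[ x · y ] i          ≡⟨ b-translation-· tx ty i ⟩
    b[ y ] i +F b[ x ] i  ≡⟨ +F-comm (b[ y ] i) (b[ x ] i) ⟩
    b[ x ] i +F b[ y ] i  ≡⟨ b-translation-· ty tx i ⟨
    b[ y · x ] i          ∎)

  neg : Raw → Raw
  neg x = proj₁ one , proj₁ (proj₂ one) , tabulate (λ i → -F b[ x ] i)

  Translation-neg : ∀ x → Translation (neg x)
  Translation-neg x = record { π≗id = π-one ; a≗1 = a-one }

  neg-inverseʳ : ∀ {x} → Translation x → x · neg x ≡ one
  neg-inverseʳ {x} tx = Translation-ext (Translation-· tx (Translation-neg x)) Translation-one (λ i → begin
    b[ x · neg x ] i             ≡⟨ b-translation-· tx (Translation-neg x) i ⟩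
    b[ neg x ] i +F b[ x ] i     ≡⟨ cong (_+F b[ x ] i) (lookup∘tabulate _ i) ⟩
    (-F b[ x ] i) +F b[ x ] i    ≡⟨ -F-inverseˡ (b[ x ] i) ⟩
    0F                           ≡⟨ b-one i ⟨
    b[ one ] i                   ∎)

  neg-inverseˡ : ∀ {x} → Translation x → neg x · x ≡ one
  neg-inverseˡ {x} tx = trans (translations-commute (Translation-neg x) tx) (neg-inverseʳ tx)

  Translation-pow : ∀ {x} → Translation x → ∀ n → Translation (pow x n)
  Translation-pow tx zero    = Translation-one
  Translation-pow tx (suc n) = Translation-· tx (Translation-pow tx n)

  b-translation-pow : ∀ {x} → Translation x → ∀ n i → b[ pow x n ] i ≡ [ n * toℕ (b[ x ] i) ]
  b-translation-pow {x} tx zero    i = b-one i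
  b-translation-pow {x} tx (suc n) i = begin
    b[ x · pow x n ] i                       ≡⟨ b-translation-· tx (Translation-pow tx n) i ⟩
    b[ pow x n ] i +F b[ x ] i               ≡⟨ cong (_+F b[ x ] i) (b-translation-pow tx n i) ⟩
    [ toℕ [ n * β ] + β ]                    ≡⟨ []-absorbˡ-+ (n * β) β ⟩
    [ n * β + β ]                            ≡⟨ cong [_] (+-comm (n * β) β) ⟩
    [ suc n * β ]                            ∎
    where β = toℕ (b[ x ] i)

  translation-pow-q : ∀ {x} → Translation x → pow x q ≡ one
  translation-pow-q {x} tx = Translation-ext (Translation-pow tx q) Translation-one (λ i → begin
    b[ pow x q ] i             ≡⟨ b-translation-pow tx q i ⟩
    [ q * toℕ (b[ x ] i) ]     ≡⟨ []-cong-% (trans (cong (_% q) (*-comm q _)) ([m+kn]%n≡m%n 0 (toℕ (b[ x ] i)) q)) ⟩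
    [ 0 ]                      ≡⟨ b-one i ⟨
    b[ one ] i                 ∎)

  Translation-conj : ∀ {x} y {y′} → Translation x → y · y′ ≡ one → Translation ((y · x) · y′)
  Translation-conj {x} y {y′} tx yy′≡one = record { π≗id = π≗ ; a≗1 = a≗ }
    where
      π≗ : ∀ i → π[ (y · x) · y′ ] i ≡ i
      π≗ i = begin
        π[ (y · x) · y′ ] i      ≡⟨ π-· (y · x) y′ i ⟩
        π[ y · x ] (π[ y′ ] i)   ≡⟨ π-·-translation tx y _ ⟩
        π[ y ] (π[ y′ ] i)       ≡⟨ π-· y y′ i ⟨
        π[ y · y′ ] i            ≡⟨ cong (λ z → π[ z ] i) yy′≡one ⟩
        π[ one ] i               ≡⟨ π-one i ⟩
        i                        ∎
      a≗ : ∀ i → a[ (y · x) · y′ ] i ≡ 1F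
      a≗ i = begin
        a[ (y · x) · y′ ] i                   ≡⟨ a-· (y · x) y′ i ⟩
        a[ y · x ] (π[ y′ ] i) *F a[ y′ ] i   ≡⟨ cong (_*F a[ y′ ] i) (a-·-translation tx y _) ⟩
        a[ y ] (π[ y′ ] i) *F a[ y′ ] i       ≡⟨ a-· y y′ i ⟨
        a[ y · y′ ] i                         ≡⟨ cong (λ z → a[ z ] i) yy′≡one ⟩
        a[ one ] i                            ≡⟨ a-one i ⟩
        1F                                    ∎

  -- Commuting with τ forces b[δ](π[τ] i) = a[τ] i · b[δ] i, so a zero of b[δ] propagates along
  -- the cycle of τ.
  commuting-translation≡one : ∀ {δ τ} i₀ → Translation δ → τ · δ ≡ δ · τ → b[ δ ] i₀ ≡ 0F →
    IsDCycle (proj₁ τ) → δ ≡ one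
  commuting-translation≡one {δ} {τ} i₀ tδ τδ≡δτ δ₀≡0 τ-cycle =
    Translation-ext tδ Translation-one (λ j → trans (vanishes j) (sym (b-one j)))
    where
      step : ∀ i → b[ δ ] i ≡ 0F → b[ δ ] (π[ τ ] i) ≡ 0F
      step i δᵢ≡0 = +F-cancelˡ (b[ τ ] i) (begin
        b[ τ ] i +F b[ δ ] (π[ τ ] i)                          ≡⟨ cong (_+F b[ δ ] (π[ τ ] i)) (*F-identityˡ (b[ τ ] i)) ⟨
        (1F *F b[ τ ] i) +F b[ δ ] (π[ τ ] i)                  ≡⟨ cong (λ s → (s *F b[ τ ] i) +F b[ δ ] (π[ τ ] i)) (a≗1 tδ _) ⟨
        (a[ δ ] (π[ τ ] i) *F b[ τ ] i) +F b[ δ ] (π[ τ ] i)   ≡⟨ b-· δ τ i ⟨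
        b[ δ · τ ] i                                           ≡⟨ cong (λ z → b[ z ] i) τδ≡δτ ⟨
        b[ τ · δ ] i                                           ≡⟨ b-· τ δ i ⟩
        (a[ τ ] (π[ δ ] i) *F b[ δ ] i) +F b[ τ ] (π[ δ ] i)   ≡⟨ cong₂ (λ s j → (a[ τ ] (π[ δ ] i) *F s) +F b[ τ ] j) δᵢ≡0 (π≗id tδ i) ⟩
        (a[ τ ] (π[ δ ] i) *F 0F) +F b[ τ ] i                  ≡⟨ cong (_+F b[ τ ] i) (*F-zeroʳ (a[ τ ] (π[ δ ] i))) ⟩
        0F +F b[ τ ] i                                         ≡⟨ +F-comm 0F (b[ τ ] i) ⟩
        b[ τ ] i +F 0F                                         ∎)
      vanishes-on-orbit : ∀ k → b[ δ ] (iter π[ τ ] k i₀) ≡ 0F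
      vanishes-on-orbit zero    = δ₀≡0
      vanishes-on-orbit (suc k) = step _ (vanishes-on-orbit k)
      vanishes : ∀ j → b[ δ ] j ≡ 0F
      vanishes j with k , τᵏi₀≡j ← τ-cycle i₀ j = subst (λ i → b[ δ ] i ≡ 0F) τᵏi₀≡j (vanishes-on-orbit k)

  open import Algebra.Properties.Monoid monoid public using (insertˡ; insertʳ; cancelˡ; cancelʳ; cancelᶜ)

  ·-cancelˡ : ∀ {y y′ a b} → y′ · y ≡ one → y · a ≡ y · b → a ≡ b
  ·-cancelˡ {y} {y′} {a} {b} y′y≡one ya≡yb =
    trans (insertˡ {a = y′} {c = y} y′y≡one a) (trans (cong (y′ ·_) ya≡yb) (cancelˡ {a = y′} {c = y} y′y≡one b))

  ·-cancelʳ : ∀ {y y′ a b} → y · y′ ≡ one → a · y ≡ b · y → a ≡ b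
  ·-cancelʳ {y} {y′} {a} {b} yy′≡one ay≡by =
    trans (insertʳ {a = y} {c = y′} yy′≡one a) (trans (cong (_· y′) ay≡by) (cancelʳ {a = y} {c = y′} yy′≡one b))

  ·-moveʳ : ∀ {x y y′ w} → y · y′ ≡ one → x · y ≡ w → x ≡ w · y′
  ·-moveʳ {x} {y} {y′} yy′≡one xy≡w = trans (insertʳ {a = y} {c = y′} yy′≡one x) (cong (_· y′) xy≡w)

  IsDCycle-conjugate : ∀ {h y y′ z} → y · y′ ≡ one → y′ · y ≡ one → h · y ≡ y · z →
    IsDCycle (proj₁ h) → IsDCycle (proj₁ z)
  IsDCycle-conjugate {h} {y} {y′} {z} yy′≡one y′y≡one hy≡yz h-cycle = Transitive-cong π≗
    (conjugate-transitive {f = π[ y ]} {g = π[ y′ ]} (π-inverse {y} {y′} yy′≡one) (π-inverse {y′} {y} y′y≡one) h-cycle)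
    where
      π-inverse : ∀ {u u′} → u · u′ ≡ one → ∀ i → π[ u ] (π[ u′ ] i) ≡ i
      π-inverse {u} {u′} uu′≡one i = trans (sym (π-· u u′ i)) (trans (cong (λ w → π[ w ] i) uu′≡one) (π-one i))
      π≗ : ∀ i → π[ y′ ] (π[ h ] (π[ y ] i)) ≡ π[ z ] i
      π≗ i = begin
        π[ y′ ] (π[ h ] (π[ y ] i))  ≡⟨ cong π[ y′ ] (π-· h y i) ⟨
        π[ y′ ] (π[ h · y ] i)       ≡⟨ π-· y′ (h · y) i ⟨
        π[ y′ · (h · y) ] i          ≡⟨ cong (λ w → π[ y′ · w ] i) hy≡yz ⟩
        π[ y′ · (y · z) ] i          ≡⟨ cong (λ w → π[ w ] i) (cancelˡ {a = y′} {c = y} y′y≡one z) ⟩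
        π[ z ] i                     ∎

  commutes-with-inverse : ∀ {a b b′} → b · b′ ≡ one → b′ · b ≡ one → a · b′ ≡ b′ · a → b · a ≡ a · b
  commutes-with-inverse {a} {b} {b′} bb′≡one b′b≡one ab′≡b′a = begin
    b · a               ≡⟨ insertʳ {a = b′} {c = b} b′b≡one (b · a) ⟩
    ((b · a) · b′) · b  ≡⟨ cong (_· b) (·-assoc b a b′) ⟩
    (b · (a · b′)) · b  ≡⟨ cong (λ z → (b · z) · b) ab′≡b′a ⟩
    (b · (b′ · a)) · b  ≡⟨ cong (_· b) (cancelˡ {a = b} {c = b′} bb′≡one a) ⟩
    a · b               ∎

  module Commutator (τ τ′ : Raw) (ττ′≡one : τ · τ′ ≡ one) (τ′τ≡one : τ′ · τ ≡ one) where

    [_,τ] : Raw → Raw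
    [ x ,τ] = ((neg x · τ′) · x) · τ

    Translation-[,τ] : ∀ {x} → Translation x → Translation [ x ,τ]
    Translation-[,τ] {x} tx = subst Translation (sym reassoc)
      (Translation-· (Translation-neg x) (Translation-conj τ′ {τ} tx τ′τ≡one))
      where
        reassoc : ((neg x · τ′) · x) · τ ≡ neg x · ((τ′ · x) · τ)
        reassoc = trans (·-assoc (neg x · τ′) x τ) (trans (·-assoc (neg x) τ′ (x · τ)) (cong (neg x ·_) (sym (·-assoc τ′ x τ))))

    -- [ x ,τ] ≡ [ y ,τ] makes y · neg x commute with τ′, hence with τ.
    [,τ]-injective : ∀ i₀ → IsDCycle (proj₁ τ) → ∀ {x y} → Translation x → Translation y →
      [ x ,τ] ≡ [ y ,τ] → b[ x ] i₀ ≡ b[ y ] i₀ → x ≡ y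
    [,τ]-injective i₀ τ-cycle {x} {y} tx ty [x,τ]≡[y,τ] x₀≡y₀ = begin
      x                 ≡⟨ ·-identityˡ x ⟨
      one · x           ≡⟨ cong (_· x) δ≡one ⟨
      (y · x̄) · x       ≡⟨ ·-assoc y x̄ x ⟩
      y · (x̄ · x)       ≡⟨ cong (y ·_) (neg-inverseˡ tx) ⟩
      y · one           ≡⟨ ·-identityʳ y ⟩
      y                 ∎
      where
        x̄ = neg x
        ȳ = neg y
        δ = y · x̄
        conjugates-equal : (x̄ · τ′) · x ≡ (ȳ · τ′) · y
        conjugates-equal = ·-cancelʳ {τ} {τ′} ττ′≡one [x,τ]≡[y,τ]
        δτ′≡τ′δ : δ · τ′ ≡ τ′ · δ
        δτ′≡τ′δ = begin
          (y · x̄) · τ′              ≡⟨ ·-assoc y x̄ τ′ ⟩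
          y · (x̄ · τ′)              ≡⟨ cancelʳ {a = x} {c = x̄} (neg-inverseʳ tx) (y · (x̄ · τ′)) ⟨
          ((y · (x̄ · τ′)) · x) · x̄  ≡⟨ cong (_· x̄) (·-assoc y (x̄ · τ′) x) ⟩
          (y · ((x̄ · τ′) · x)) · x̄  ≡⟨ cong (λ z → (y · z) · x̄) conjugates-equal ⟩
          (y · ((ȳ · τ′) · y)) · x̄  ≡⟨ cong (λ z → (y · z) · x̄) (·-assoc ȳ τ′ y) ⟩
          (y · (ȳ · (τ′ · y))) · x̄  ≡⟨ cong (_· x̄) (cancelˡ {a = y} {c = ȳ} (neg-inverseʳ ty) (τ′ · y)) ⟩
          (τ′ · y) · x̄              ≡⟨ ·-assoc τ′ y x̄ ⟩
          τ′ · (y · x̄)              ∎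
        δ₀≡0 : b[ δ ] i₀ ≡ 0F
        δ₀≡0 = begin
          b[ y · x̄ ] i₀              ≡⟨ b-translation-· ty (Translation-neg x) i₀ ⟩
          b[ x̄ ] i₀ +F b[ y ] i₀     ≡⟨ cong₂ _+F_ (lookup∘tabulate _ i₀) (sym x₀≡y₀) ⟩
          (-F b[ x ] i₀) +F b[ x ] i₀ ≡⟨ -F-inverseˡ (b[ x ] i₀) ⟩
          0F                          ∎
        δ≡one : δ ≡ one
        δ≡one = commuting-translation≡one {δ} {τ} i₀ (Translation-· ty (Translation-neg x))
          (commutes-with-inverse {δ} {τ} {τ′} ττ′≡one τ′τ≡one δτ′≡τ′δ) δ₀≡0 τ-cycle

module CosetSpace (q : ℕ) .{{q≢0 : NonZero q}} (d : ℕ) where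
  open import Defs using (module Wr; allVec; iter)
  open Wr q d
  open WreathProduct q d
  open Counting
  open FixedPoints using (Invariant; Periodic; Commute)
  open import Data.Bool using (Bool; true; _∧_)
  open import Data.Bool.Properties using (⇔→≡) renaming (_≟_ to _≟ᵇ_)
  import Data.Fin as Fin
  open import Data.List using (List; map; length; filter; cartesianProduct; findᵇ)
  open import Data.List.Properties using (concatMap-cong; length-map)
  open import Data.List.Membership.Propositional using (lose) renaming (_∈_ to _∈ᴸ_)
  open import Data.List.Membership.Propositional.Properties
    using (∈-map⁺; ∈-map⁻; ∈-filter⁺; ∈-filter⁻; ∈-cartesianProduct⁺; ∈-cartesianProduct⁻)
  open import Data.List.Relation.Unary.Any using (any?; satisfied)
  open import Data.List.Relation.Unary.Unique.Propositional using (Unique)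
  import Data.List.Relation.Unary.Unique.Propositional.Properties as Unique
  open import Data.Maybe using (just; fromMaybe)
  open import Data.Nat using (zero; suc; _*_)
  open import Data.Product using (∃; _×_; _,_; proj₁; proj₂; uncurry)
  import Data.Product.Properties as Product
  open import Data.Vec.Properties using (≡-dec)
  open import Function using (_⇔_; mk⇔)
  open import Relation.Binary.Definitions using (DecidableEquality)
  open import Relation.Binary.PropositionalEquality
  open import Relation.Nullary using (does; _×-dec_)
  open import Relation.Nullary.Decidable using (dec-true)
  open ≡-Reasoning

  infix 4 _≟ᴿ_
  _≟ᴿ_ : DecidableEquality Raw
  _≟ᴿ_ = Product.≡-dec (≡-dec Fin._≟_) (Product.≡-dec (≡-dec Fin._≟_) (≡-dec Fin._≟_))

  allRaw≡cartesianProduct : allRaw ≡ cartesianProduct (allVec d d) (cartesianProduct (allVec d q) (allVec d q))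
  allRaw≡cartesianProduct = trans
    (concatMap-cong (λ π → trans (concatMap-map≡cartesianProductWith (λ a b → π , a , b) (allVec d q) (allVec d q))
                                 (sym (map-cartesianProductWith _,_ (π ,_) (allVec d q) (allVec d q))))
                    (allVec d d))
    (concatMap-map≡cartesianProductWith _,_ (allVec d d) (cartesianProduct (allVec d q) (allVec d q)))

  allRaw-complete : ∀ x → x ∈ᴸ allRaw
  allRaw-complete (π , a , b) rewrite allRaw≡cartesianProduct =
    ∈-cartesianProduct⁺ (allVec-complete d d π) (∈-cartesianProduct⁺ (allVec-complete d q a) (allVec-complete d q b))

  allRaw-unique : Unique allRaw
  allRaw-unique rewrite allRaw≡cartesianProduct =
    Unique.cartesianProduct⁺ (allVec-unique d d) (Unique.cartesianProduct⁺ (allVec-unique d q) (allVec-unique d q))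

  elements : Subset → List Raw
  elements H = filter (λ x → H x ≟ᵇ true) allRaw

  ∈-elements⁺ : ∀ {H x} → x ∈ H → x ∈ᴸ elements H
  ∈-elements⁺ {H} {x} x∈H = ∈-filter⁺ (λ x → H x ≟ᵇ true) (allRaw-complete x) x∈H

  ∈-elements⁻ : ∀ {H x} → x ∈ᴸ elements H → x ∈ H
  ∈-elements⁻ {H} x∈ = proj₂ (∈-filter⁻ (λ x → H x ≟ᵇ true) {xs = allRaw} x∈)

  elements-unique : ∀ H → Unique (elements H)
  elements-unique H = Unique.filter⁺ (λ x → H x ≟ᵇ true) {allRaw} allRaw-unique

  length-elements : ∀ H → length (elements H) ≡ ∣ H ∣
  length-elements H = sym (count≡length∘filter H allRaw)

  module Cosets (G Q : Subset) (G-subgroup : IsSubgroup G) (Q-subgroup : IsSubgroup Q) (Q⊆G : Q ⊆ G) where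

    open IsSubgroup
    open Enumeration allRaw allRaw-complete allRaw-unique

    InCoset : Raw → Raw → Bool
    InCoset x w = does (any? (λ z → (Q z ≟ᵇ true) ×-dec ((x · z) ≟ᴿ w)) allRaw)

    InCoset⁻ : ∀ x {w} → InCoset x w ≡ true → ∃ λ z → z ∈ Q × x · z ≡ w
    InCoset⁻ x {w} h = satisfied (does-true⁻ (any? _ allRaw) h)

    InCoset⁺ : ∀ x {z} → z ∈ Q → InCoset x (x · z) ≡ true
    InCoset⁺ x {z} z∈Q = dec-true (any? _ allRaw) (lose (allRaw-complete z) (z∈Q , refl))

    InCoset-cong : ∀ x {z} → z ∈ Q → ∀ w → InCoset (x · z) w ≡ InCoset x w
    InCoset-cong x {z} z∈Q w = ⇔→≡ {z = true} (mk⇔ shrink grow)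
      where
        shrink : InCoset (x · z) w ≡ true → InCoset x w ≡ true
        shrink h with z′ , z′∈Q , xzz′≡w ← InCoset⁻ (x · z) h =
          subst (λ v → InCoset x v ≡ true) (trans (sym (·-assoc x z z′)) xzz′≡w) (InCoset⁺ x (mul∈ Q-subgroup z z′ z∈Q z′∈Q))
        grow : InCoset x w ≡ true → InCoset (x · z) w ≡ true
        grow h =
          let z′ , z′∈Q , xz′≡w = InCoset⁻ x h
              z⁻¹ , z⁻¹∈Q , zz⁻¹≡one , _ = inv∈ Q-subgroup z z∈Q
          in subst (λ v → InCoset (x · z) v ≡ true) (trans (cancelᶜ {a = z} {c = z⁻¹} zz⁻¹≡one x z′) xz′≡w)
                   (InCoset⁺ (x · z) (mul∈ Q-subgroup z⁻¹ z′ z⁻¹∈Q z′∈Q))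

    -- The first element of xQ in allRaw; the default is never used, as x ∈ xQ. Kept opaque so
    -- that conversion checking compares representatives by their arguments instead of unfolding
    -- the search.
    opaque
      rep : Raw → Raw
      rep x = fromMaybe one (findᵇ (InCoset x) allRaw)

    opaque
      unfolding rep

      rep∈coset : ∀ x → ∃ λ z → z ∈ Q × x · z ≡ rep x
      rep∈coset x = found⇒ (findᵇ-complete (InCoset x) (allRaw-complete x) x∈xQ)
        where
          x∈xQ : InCoset x x ≡ true
          x∈xQ = subst (λ v → InCoset x v ≡ true) (·-identityʳ x) (InCoset⁺ x (one∈ Q-subgroup))
          found⇒ : (∃ λ w → findᵇ (InCoset x) allRaw ≡ just w) → ∃ λ z → z ∈ Q × x · z ≡ rep x
          found⇒ (w , found) = subst (λ v → ∃ λ z → z ∈ Q × x · z ≡ v) (sym (cong (fromMaybe one) found))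
                                     (InCoset⁻ x (findᵇ-sound (InCoset x) allRaw found))

      rep-cong : ∀ x {z} → z ∈ Q → rep (x · z) ≡ rep x
      rep-cong x z∈Q = cong (fromMaybe one) (findᵇ-cong (InCoset-cong x z∈Q) allRaw)

    rep-idem : ∀ x → rep (rep x) ≡ rep x
    rep-idem x = let z , z∈Q , xz≡rep = rep∈coset x in trans (cong rep (sym xz≡rep)) (rep-cong x z∈Q)

    rep-∈G : ∀ {x} → x ∈ G → rep x ∈ G
    rep-∈G {x} x∈G = let z , z∈Q , xz≡rep = rep∈coset x in subst (_∈ G) xz≡rep (mul∈ G-subgroup x z x∈G (Q⊆G z z∈Q))

    rep-·ʳ : ∀ p x → rep (p · rep x) ≡ rep (p · x)
    rep-·ʳ p x = let z , z∈Q , xz≡rep = rep∈coset x in begin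
      rep (p · rep x)    ≡⟨ cong (λ v → rep (p · v)) xz≡rep ⟨
      rep (p · (x · z))  ≡⟨ cong rep (·-assoc p x z) ⟨
      rep ((p · x) · z)  ≡⟨ rep-cong (p · x) z∈Q ⟩
      rep (p · x)        ∎

    rep∈coset⁻¹ : ∀ x → ∃ λ z → z ∈ Q × rep x · z ≡ x
    rep∈coset⁻¹ x =
      let z , z∈Q , xz≡rep = rep∈coset x
          z⁻¹ , z⁻¹∈Q , zz⁻¹≡one , _ = inv∈ Q-subgroup z z∈Q
      in z⁻¹ , z⁻¹∈Q , sym (·-moveʳ {y = z} {y′ = z⁻¹} zz⁻¹≡one xz≡rep)

    -- G/Q is modelled by the set of canonical representatives of the cosets of Q in G.
    Transversal : Subset
    Transversal x = G x ∧ does (rep x ≟ᴿ x)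

    Transversal⁻ : ∀ {t} → t ∈ Transversal → t ∈ G × rep t ≡ t
    Transversal⁻ {t} t∈T = proj₁ (∧-true⁻ t∈T) , does-true⁻ (rep t ≟ᴿ t) (proj₂ (∧-true⁻ t∈T))

    rep∈Transversal : ∀ {x} → x ∈ G → rep x ∈ Transversal
    rep∈Transversal {x} x∈G = cong₂ _∧_ (rep-∈G x∈G) (dec-true (rep (rep x) ≟ᴿ rep x) (rep-idem x))

    factorisation-unique : ∀ {t t′ z z′} → t ∈ Transversal → t′ ∈ Transversal → z ∈ Q → z′ ∈ Q →
      t · z ≡ t′ · z′ → t ≡ t′ × z ≡ z′
    factorisation-unique {t} {t′} {z} {z′} t∈T t′∈T z∈Q z′∈Q tz≡t′z′ = t≡t′ , z≡z′
      where
        t≡t′ : t ≡ t′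
        t≡t′ = begin
          t              ≡⟨ proj₂ (Transversal⁻ t∈T) ⟨
          rep t          ≡⟨ rep-cong t z∈Q ⟨
          rep (t · z)    ≡⟨ cong rep tz≡t′z′ ⟩
          rep (t′ · z′)  ≡⟨ rep-cong t′ z′∈Q ⟩
          rep t′         ≡⟨ proj₂ (Transversal⁻ t′∈T) ⟩
          t′             ∎
        z≡z′ : z ≡ z′
        z≡z′ = let t⁻¹ , _ , _ , t⁻¹t≡one = inv∈ G-subgroup t (proj₁ (Transversal⁻ t∈T)) in
          ·-cancelˡ {t} {t⁻¹} t⁻¹t≡one (trans tz≡t′z′ (cong (_· z′) (sym t≡t′)))

    lagrange : ∣ G ∣ ≡ ∣ Transversal ∣ * ∣ Q ∣
    lagrange = begin
      ∣ G ∣                                ≡⟨ count≡length G products-unique G⇔products ⟩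
      length products                      ≡⟨ length-map (uncurry _·_) (cartesianProduct Ts Qs) ⟩
      length (cartesianProduct Ts Qs)      ≡⟨ length-cartesianProductWith _,_ Ts Qs ⟩
      length Ts * length Qs                ≡⟨ cong₂ _*_ (length-elements Transversal) (length-elements Q) ⟩
      ∣ Transversal ∣ * ∣ Q ∣              ∎
      where
        Ts Qs : List Raw
        Ts = elements Transversal
        Qs = elements Q
        products : List Raw
        products = map (uncurry _·_) (cartesianProduct Ts Qs)
        factors : ∀ {u} → u ∈ᴸ cartesianProduct Ts Qs → proj₁ u ∈ Transversal × proj₂ u ∈ Q
        factors u∈ = let t∈ , z∈ = ∈-cartesianProduct⁻ Ts Qs u∈ in ∈-elements⁻ t∈ , ∈-elements⁻ z∈
        products-unique : Unique products
        products-unique = Unique-map⁺-on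
          (λ u∈ v∈ same → let t∈T , z∈Q = factors u∈ ; t′∈T , z′∈Q = factors v∈
                              t≡t′ , z≡z′ = factorisation-unique t∈T t′∈T z∈Q z′∈Q same
                          in cong₂ _,_ t≡t′ z≡z′)
          (Unique.cartesianProduct⁺ (elements-unique Transversal) (elements-unique Q))
        G⇔products : ∀ {w} → G w ≡ true ⇔ w ∈ᴸ products
        G⇔products {w} = mk⇔
          (λ w∈G → let z , z∈Q , rep·z≡w = rep∈coset⁻¹ w in subst (_∈ᴸ products) rep·z≡w
             (∈-map⁺ (uncurry _·_) (∈-cartesianProduct⁺ (∈-elements⁺ (rep∈Transversal w∈G)) (∈-elements⁺ z∈Q))))
          (λ w∈ → let (t , z) , u∈ , w≡tz = ∈-map⁻ (uncurry _·_) w∈ ; t∈T , z∈Q = factors u∈ in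
             subst (_∈ G) (sym w≡tz) (mul∈ G-subgroup t z (proj₁ (Transversal⁻ t∈T)) (Q⊆G z z∈Q)))

    act : Raw → Raw → Raw
    act p x = rep (p · x)

    act-invariant : ∀ {p} → p ∈ G → Invariant (act p) Transversal
    act-invariant {p} p∈G {x} x∈T = rep∈Transversal (mul∈ G-subgroup p x p∈G (proj₁ (Transversal⁻ x∈T)))

    iter-act : ∀ p {x} → x ∈ Transversal → ∀ n → iter (act p) n x ≡ rep (pow p n · x)
    iter-act p {x} x∈T zero    = trans (sym (proj₂ (Transversal⁻ x∈T))) (cong rep (sym (·-identityˡ x)))
    iter-act p {x} x∈T (suc n) = begin
      rep (p · iter (act p) n x)    ≡⟨ cong (λ v → rep (p · v)) (iter-act p x∈T n) ⟩
      rep (p · rep (pow p n · x))   ≡⟨ rep-·ʳ p (pow p n · x) ⟩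
      rep (p · (pow p n · x))       ≡⟨ cong rep (·-assoc p (pow p n) x) ⟨
      rep (pow p (suc n) · x)       ∎

    act-periodic : ∀ {p n} → pow p n ≡ one → Periodic n (act p) Transversal
    act-periodic {p} {n} pⁿ≡one {x} x∈T = begin
      iter (act p) n x    ≡⟨ iter-act p x∈T n ⟩
      rep (pow p n · x)   ≡⟨ cong (λ v → rep (v · x)) pⁿ≡one ⟩
      rep (one · x)       ≡⟨ cong rep (·-identityˡ x) ⟩
      rep x               ≡⟨ proj₂ (Transversal⁻ x∈T) ⟩
      x                   ∎

    act-commute : ∀ {p p′} → p · p′ ≡ p′ · p → Commute (act p) (act p′) Transversal
    act-commute {p} {p′} pp′≡p′p {x} _ = begin
      rep (p · rep (p′ · x))  ≡⟨ rep-·ʳ p (p′ · x) ⟩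
      rep (p · (p′ · x))      ≡⟨ cong rep (·-assoc p p′ x) ⟨
      rep ((p · p′) · x)      ≡⟨ cong (λ v → rep (v · x)) pp′≡p′p ⟩
      rep ((p′ · p) · x)      ≡⟨ cong rep (·-assoc p′ p x) ⟩
      rep (p′ · (p · x))      ≡⟨ rep-·ʳ p′ (p · x) ⟨
      rep (p′ · rep (p · x))  ∎

    act-fixed⇒conjugate∈Q : ∀ {p x} → act p x ≡ x → ∃ λ z → z ∈ Q × p · x ≡ x · z
    act-fixed⇒conjugate∈Q {p} {x} fixed =
      let z , z∈Q , rep·z≡px = rep∈coset⁻¹ (p · x) in z , z∈Q , trans (sym rep·z≡px) (cong (_· z) fixed)

open Counting
open FixedPoints
open TransitiveMaps
open PrimePowers
open import Data.Bool using (_∧_)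
open import Data.Fin using (Fin; toℕ; fromℕ<)
open import Data.Fin.Properties using (toℕ-fromℕ<) renaming (_≟_ to _≟ᶠ_)
open import Data.List using (List; map)
open import Data.List.Properties using (length-map)
open import Data.List.Membership.Propositional using () renaming (_∈_ to _∈ᴸ_)
open import Data.List.Membership.Propositional.Properties using (∈-map⁺; ∈-map⁻)
import Data.List.Relation.Unary.All as All
open import Data.Nat using (ℕ; zero; suc; _+_; _*_; _∸_; _^_; _≤_; _<_; z≤n; s≤s; NonZero; nonTrivial⇒n>1)
open import Data.Nat.Properties
open import Data.Nat.Divisibility using (_∣_)
open import Data.Nat.Primality using (Prime; prime⇒nonZero; prime⇒nonTrivial)
open import Data.Nat.Coprimality using (Coprime)
open import Algebra.Properties.CommutativeSemigroup *-commutativeSemigroup using (x∙yz≈y∙xz)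
open import Data.Product using (∃; ∃₂; _×_; _,_; proj₁; proj₂)
open import Data.Vec using (Vec; lookup; tabulate)
open import Data.Vec.Properties using (lookup∘tabulate; ≡-dec)
open import Relation.Binary.PropositionalEquality
open import Relation.Nullary using (¬_)
open ≡-Reasoning

module ElementOrders (q : ℕ) .{{q≢0 : NonZero q}} (d : ℕ) where
  open Wr q d
  open WreathProduct q d
  open CosetSpace q d
  open Enumeration allRaw allRaw-complete allRaw-unique
  open IsSubgroup

  pow-∈ : ∀ {H x} → IsSubgroup H → x ∈ H → ∀ n → pow x n ∈ H
  pow-∈ H-subgroup x∈H zero    = one∈ H-subgroup
  pow-∈ H-subgroup x∈H (suc n) = mul∈ H-subgroup _ _ x∈H (pow-∈ H-subgroup x∈H n)

  finite-order : ∀ {H x} → IsSubgroup H → x ∈ H → ∃ λ N → 0 < N × pow x N ≡ one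
  finite-order {H} {x} H-subgroup x∈H = from-collision (pigeonhole-ℕ (pow x))
    where
      from-collision : (∃₂ λ a b → a < b × pow x a ≡ pow x b) → ∃ λ N → 0 < N × pow x N ≡ one
      from-collision (a , b , a<b , xᵃ≡xᵇ) =
        let y , _ , xᵃy≡one , _ = inv∈ H-subgroup (pow x a) (pow-∈ H-subgroup x∈H a) in
        b ∸ a , m<n⇒0<n∸m a<b , ·-cancelʳ {pow x a} {y} xᵃy≡one (begin
          pow x (b ∸ a) · pow x a   ≡⟨ pow-+ x (b ∸ a) a ⟨
          pow x (b ∸ a + a)         ≡⟨ cong (pow x) (m∸n+n≡m (<⇒≤ a<b)) ⟩
          pow x b                   ≡⟨ xᵃ≡xᵇ ⟨
          pow x a                   ≡⟨ ·-identityˡ (pow x a) ⟨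
          one · pow x a             ∎)

  q-power-cycle : ∀ {G σ} → Prime q → ∀ r → d ≡ q ^ r → IsSubgroup G → σ ∈ G → IsDCycle (proj₁ σ) →
    ∃ λ h → h ∈ G × (∃ λ s → pow h (q ^ s) ≡ one) × IsDCycle (proj₁ h)
  q-power-cycle {G} {σ} q-prime r d≡qʳ G-subgroup σ∈G σ-cycle =
    let N , N>0 , σᴺ≡one = finite-order G-subgroup σ∈G
        s , u , N≡qˢu , q∤u = q-adic-decomposition q-prime N N>0
        x , σˣᵘ-transitive = coprime-iterate-transitive σ-cycle
                               (subst (Coprime u) (sym d≡qʳ) (∤⇒coprime-^ q-prime q∤u r))
    in pow σ (x * u) , pow-∈ G-subgroup σ∈G (x * u) , (s , q-power-order N {s} {u} N≡qˢu σᴺ≡one x)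
     , Transitive-cong (λ i → sym (π-pow σ (x * u) i)) σˣᵘ-transitive
    where
      q-power-order : ∀ N {s u} → N ≡ q ^ s * u → pow σ N ≡ one → ∀ x → pow (pow σ (x * u)) (q ^ s) ≡ one
      q-power-order N {s} {u} N≡qˢu σᴺ≡one x = begin
        pow (pow σ (x * u)) (q ^ s)  ≡⟨ pow-pow σ (q ^ s) (x * u) ⟩
        pow σ (q ^ s * (x * u))      ≡⟨ cong (pow σ) (trans (x∙yz≈y∙xz (q ^ s) x u) (cong (x *_) (sym N≡qˢu))) ⟩
        pow σ (x * N)                ≡⟨ pow-pow σ x N ⟨
        pow (pow σ N) x              ≡⟨ cong (λ y → pow y x) σᴺ≡one ⟩
        pow one x                    ≡⟨ pow-one x ⟩
        one                          ∎

module SylowArguments (q : ℕ) (q-prime : Prime q) (d : ℕ) where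
  private instance
    q≢0 : NonZero q
    q≢0 = prime⇒nonZero q-prime
  open Wr q d
  open WreathProduct q d
  open CosetSpace q d
  open IsSubgroup
  open PrimePowerOrder _≟ᴿ_ allRaw allRaw-complete allRaw-unique q-prime

  module _ {G Q : Subset} (G-subgroup : IsSubgroup G) (Q-subgroup : IsSubgroup Q) (Q⊆G : Q ⊆ G)
           (k : ℕ) {m : ℕ} (|G|≡qᵏm : ∣ G ∣ ≡ q ^ k * m) (q∤m : ¬ q ∣ m) (|Q|≡qᵏ : ∣ Q ∣ ≡ q ^ k) where

    open Cosets G Q G-subgroup Q-subgroup Q⊆G

    q∤∣Transversal∣ : ¬ q ∣ ∣ Transversal ∣
    q∤∣Transversal∣ = subst (λ n → ¬ q ∣ n) (sym ∣Transversal∣≡m) q∤m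
      where
        ∣Transversal∣≡m : ∣ Transversal ∣ ≡ m
        ∣Transversal∣≡m = *-cancelʳ-≡ ∣ Transversal ∣ m (q ^ k) {{m^n≢0 q k}} (begin
          ∣ Transversal ∣ * q ^ k      ≡⟨ cong (∣ Transversal ∣ *_) |Q|≡qᵏ ⟨
          ∣ Transversal ∣ * ∣ Q ∣      ≡⟨ lagrange ⟨
          ∣ G ∣                        ≡⟨ |G|≡qᵏm ⟩
          q ^ k * m                    ≡⟨ *-comm (q ^ k) m ⟩
          m * q ^ k                    ∎)

    conjugate-cycle-into-Q : ∀ {h} s → h ∈ G → pow h (q ^ s) ≡ one → IsDCycle (proj₁ h) →
      ∃ λ τ → τ ∈ Q × IsDCycle (proj₁ τ)
    conjugate-cycle-into-Q {h} s h∈G hᵠˢ≡one h-cycle =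
      let x , x∈T∧fixed = ¬q∣count⇒∃ (¬q∣count⇒¬q∣count-fixed-^ s (act-invariant h∈G)
                                        (act-periodic {h} {q ^ s} hᵠˢ≡one) q∤∣Transversal∣)
          x∈T , fixed = ∧-true⁻ {Transversal x} x∈T∧fixed
          z , z∈Q , hx≡xz = act-fixed⇒conjugate∈Q {h} {x} (does-true⁻ (act h x ≟ᴿ x) fixed)
          x⁻¹ , _ , xx⁻¹≡one , x⁻¹x≡one = inv∈ G-subgroup x (proj₁ (Transversal⁻ x∈T))
      in z , z∈Q , IsDCycle-conjugate {h} {x} {x⁻¹} {z} xx⁻¹≡one x⁻¹x≡one hx≡xz h-cycle

    -- A coset xQ fixed by all of G_q gives x⁻¹ G_q x ⊆ Q; as G_q is normal, apply this to
    -- x t x⁻¹ ∈ G_q to get t ∈ Q.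
    translations⊆Q : (G ∩ inCqd) ⊆ Q
    translations⊆Q = from-common-fixed-point
      (common-fixed-point 1 actions invariant periodic commute q∤∣Transversal∣)
      where
        Gq⁻ : ∀ {p} → p ∈ (G ∩ inCqd) → p ∈ G × Translation p
        Gq⁻ {p} p∈ = proj₁ (∧-true⁻ {G p} p∈) , ∩inCqd⇒Translation {G} p∈
        actions : List (Raw → Raw)
        actions = map act (elements (G ∩ inCqd))
        action⁻ : ∀ {f} → f ∈ᴸ actions → ∃ λ p → p ∈ (G ∩ inCqd) × f ≡ act p
        action⁻ f∈ = let p , p∈ , f≡ = ∈-map⁻ act f∈ in p , ∈-elements⁻ p∈ , f≡
        invariant : ∀ {f} → f ∈ᴸ actions → Invariant f Transversal
        invariant f∈ = let p , p∈ , f≡ = action⁻ f∈ in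
          subst (λ g → Invariant g Transversal) (sym f≡) (act-invariant (proj₁ (Gq⁻ p∈)))
        periodic : ∀ {f} → f ∈ᴸ actions → Periodic (q ^ 1) f Transversal
        periodic f∈ = let p , p∈ , f≡ = action⁻ f∈ in
          subst (λ g → Periodic (q ^ 1) g Transversal) (sym f≡)
            (act-periodic {p} {q ^ 1} (trans (cong (pow p) (*-identityʳ q)) (translation-pow-q (proj₂ (Gq⁻ p∈)))))
        commute : ∀ {f g} → f ∈ᴸ actions → g ∈ᴸ actions → Commute f g Transversal
        commute f∈ g∈ = let p , p∈ , f≡ = action⁻ f∈ ; p′ , p′∈ , g≡ = action⁻ g∈ in
          subst₂ (λ f g → Commute f g Transversal) (sym f≡) (sym g≡)
            (act-commute {p} {p′} (translations-commute (proj₂ (Gq⁻ p∈)) (proj₂ (Gq⁻ p′∈))))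
        from-common-fixed-point : (∃ λ x → x ∈ Transversal × All.All (λ f → f x ≡ x) actions) → (G ∩ inCqd) ⊆ Q
        from-common-fixed-point (x , x∈T , fixes) t t∈Gq =
          let x⁻¹ , x⁻¹∈G , xx⁻¹≡one , x⁻¹x≡one = inv∈ G-subgroup x x∈G
              t∈G , t-translation = Gq⁻ t∈Gq
              conj = (x · t) · x⁻¹
              conj∈Gq : conj ∈ (G ∩ inCqd)
              conj∈Gq = cong₂ _∧_ (mul∈ G-subgroup (x · t) x⁻¹ (mul∈ G-subgroup x t x∈G t∈G) x⁻¹∈G)
                                  (Translation⇒inCqd (Translation-conj x {x⁻¹} t-translation xx⁻¹≡one))
              z , z∈Q , conj·x≡xz = act-fixed⇒conjugate∈Q {conj} {x} (All.lookup fixes (∈-map⁺ act (∈-elements⁺ conj∈Gq)))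
              xt≡xz = trans (sym (cancelʳ {a = x⁻¹} {c = x} x⁻¹x≡one (x · t))) conj·x≡xz
          in subst (_∈ Q) (sym (·-cancelˡ {x} {x⁻¹} x⁻¹x≡one xt≡xz)) z∈Q
          where x∈G = proj₁ (Transversal⁻ x∈T)

module CommutatorBound (q : ℕ) .{{q≢0 : NonZero q}} (d : ℕ) where
  open Wr q d
  open WreathProduct q d
  open CosetSpace q d
  open IsSubgroup

  module _ {Q : Subset} (τ τ′ : Raw) (τ∈Q : τ ∈ Q) (ττ′≡one : τ · τ′ ≡ one) (τ′τ≡one : τ′ · τ ≡ one) where

    open Commutator τ τ′ ττ′≡one τ′τ≡one

    Translation-[,τ]ⁿ : ∀ n {t} → Translation t → Translation (iter [_,τ] n t)
    Translation-[,τ]ⁿ zero    t-translation = t-translation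
    Translation-[,τ]ⁿ (suc n) t-translation = Translation-[,τ] (Translation-[,τ]ⁿ n t-translation)

    LCS-[,τ]ⁿ : ∀ n {t} → t ∈ Q → Translation t → LCS Q n (iter [_,τ] n t)
    LCS-[,τ]ⁿ zero    t∈Q _             = t∈Q
    LCS-[,τ]ⁿ (suc n) {t} t∈Q t-translation = gen (x , τ , neg x , τ′ , LCS-[,τ]ⁿ n t∈Q t-translation , τ∈Q ,
      neg-inverseʳ (Translation-[,τ]ⁿ n t-translation) , ττ′≡one , refl)
      where x = iter [_,τ] n t

    module _ {H : Subset} (H⊆Q : H ⊆ Q) (H-translations : ∀ {x} → x ∈ H → Translation x)
             (i₀ : Fin d) (τ-cycle : IsDCycle (proj₁ τ)) (i : ℕ) (lcsᵢ≡one : ∀ x → LCS Q i x → x ≡ one) where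

      signature : Raw → Vec (Fin q) i
      signature t = tabulate (λ a → b[ iter [_,τ] (toℕ a) t ] i₀)

      signature-injective : ∀ {t s} → t ∈ H → s ∈ H → signature t ≡ signature s → t ≡ s
      signature-injective {t} {s} t∈H s∈H same = agree-from 0 i refl
        where
          vanishes : ∀ {x} → x ∈ H → iter [_,τ] i x ≡ one
          vanishes x∈H = lcsᵢ≡one _ (LCS-[,τ]ⁿ i (H⊆Q _ x∈H) (H-translations x∈H))
          coordinate : ∀ a → a < i → b[ iter [_,τ] a t ] i₀ ≡ b[ iter [_,τ] a s ] i₀
          coordinate a a<i = begin
            b[ iter [_,τ] a t ] i₀                   ≡⟨ cong (λ n → b[ iter [_,τ] n t ] i₀) (toℕ-fromℕ< a<i) ⟨
            b[ iter [_,τ] (toℕ (fromℕ< a<i)) t ] i₀  ≡⟨ lookup∘tabulate _ (fromℕ< a<i) ⟨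
            lookup (signature t) (fromℕ< a<i)        ≡⟨ cong (λ v → lookup v (fromℕ< a<i)) same ⟩
            lookup (signature s) (fromℕ< a<i)        ≡⟨ lookup∘tabulate _ (fromℕ< a<i) ⟩
            b[ iter [_,τ] (toℕ (fromℕ< a<i)) s ] i₀  ≡⟨ cong (λ n → b[ iter [_,τ] n s ] i₀) (toℕ-fromℕ< a<i) ⟩
            b[ iter [_,τ] a s ] i₀                   ∎
          agree-from : ∀ a b → a + b ≡ i → iter [_,τ] a t ≡ iter [_,τ] a s
          agree-from a zero    a+0≡i = subst (λ n → iter [_,τ] n t ≡ iter [_,τ] n s) (trans (sym a+0≡i) (+-identityʳ a))
            (trans (vanishes t∈H) (sym (vanishes s∈H)))
          agree-from a (suc b) a+1+b≡i = [,τ]-injective i₀ τ-cycle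
            (Translation-[,τ]ⁿ a (H-translations t∈H)) (Translation-[,τ]ⁿ a (H-translations s∈H))
            (agree-from (suc a) b (trans (sym (+-suc a b)) a+1+b≡i))
            (coordinate a (subst (a <_) a+1+b≡i (m<m+n a (s≤s z≤n))))

      ∣H∣≤qⁱ : ∣ H ∣ ≤ q ^ i
      ∣H∣≤qⁱ = subst₂ _≤_ (trans (length-map signature (elements H)) (length-elements H)) (length-allVec i q)
        (unique-length≤ (≡-dec _≟ᶠ_) (Unique-map⁺-on (λ x∈ y∈ → signature-injective (∈-elements⁻ x∈) (∈-elements⁻ y∈))
                                                      (elements-unique H)))
        where open Enumeration (allVec i q) (allVec-complete i q) (allVec-unique i q) using (unique-length≤)

  ∣translations∣≤qⁱ : ∀ {Q H} τ → IsSubgroup Q → τ ∈ Q → IsDCycle (proj₁ τ) → H ⊆ Q →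
    (∀ {x} → x ∈ H → Translation x) → Fin d → ∀ i → (∀ x → LCS Q i x → x ≡ one) → ∣ H ∣ ≤ q ^ i
  ∣translations∣≤qⁱ {Q} {H} τ Q-subgroup τ∈Q τ-cycle H⊆Q H-translations i₀ i lcsᵢ≡one =
    let τ′ , _ , ττ′≡one , τ′τ≡one = inv∈ Q-subgroup τ τ∈Q in
    ∣H∣≤qⁱ τ τ′ τ∈Q ττ′≡one τ′τ≡one H⊆Q H-translations i₀ τ-cycle i lcsᵢ≡one

corollary2p25 : (q r d : ℕ) → (qp : Prime q) → 1 ≤ r → d ≡ q ^ r →
    let open Wr q {{prime⇒nonZero qp}} d in
    (G : Subset) → IsSubgroup G →
    (σ : Raw) → σ ∈ G → IsDCycle (proj₁ σ) →
    (e : ℕ) → ∣ G ∩ inCqd ∣ ≡ q ^ e →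
    (Q : Subset) → IsSubgroup Q → Q ⊆ G →
    (k m : ℕ) → ∣ G ∣ ≡ q ^ k * m → ¬ (q ∣ m) → ∣ Q ∣ ≡ q ^ k →
    (i : ℕ) → (∀ x → LCS Q i x → x ≡ one) → e ≤ i
corollary2p25 q r d q-prime _ d≡qʳ G G-subgroup σ σ∈G σ-cycle e |Gq|≡qᵉ Q Q-subgroup Q⊆G k m |G|≡qᵏm q∤m |Q|≡qᵏ i lcsᵢ≡one =
  let h , h∈G , (s , hᵠˢ≡one) , h-cycle = q-power-cycle q-prime r d≡qʳ G-subgroup σ∈G σ-cycle
      τ , τ∈Q , τ-cycle = conjugate-cycle-into-Q G-subgroup Q-subgroup Q⊆G k |G|≡qᵏm q∤m |Q|≡qᵏ s h∈G hᵠˢ≡one h-cycle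
      ∣Gq∣≤qⁱ = ∣translations∣≤qⁱ τ Q-subgroup τ∈Q τ-cycle
                  (translations⊆Q G-subgroup Q-subgroup Q⊆G k |G|≡qᵏm q∤m |Q|≡qᵏ) (∩inCqd⇒Translation {G}) i₀ i lcsᵢ≡one
  in ≮⇒≥ (λ i<e → <⇒≱ (^-monoʳ-< q (nonTrivial⇒n>1 q {{prime⇒nonTrivial q-prime}}) i<e) (subst (_≤ q ^ i) |Gq|≡qᵉ ∣Gq∣≤qⁱ))
  where
    instance
      q≢0 : NonZero q
      q≢0 = prime⇒nonZero q-prime
    open Wr q d
    open ElementOrders q d
    open SylowArguments q q-prime d
    open CommutatorBound q d
    open WreathProduct q d using (∩inCqd⇒Translation)
    i₀ : Fin d
    i₀ = fromℕ< (subst (0 <_) (sym d≡qʳ) (m^n>0 q r))
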